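{- Let $\mathcal{X}$ be a finite set, let $\ast$ be an ergodic operation on $\mathcal{X}$, and let $\mathcal{H}$ be a stable partition of $(\mathcal{X},\ast)$. Then there exists a unique stable partition $\mathcal{K}_{\mathcal{H}}$ of $(\mathcal{X},\ast)$ with $\mathcal{K}_{\mathcal{H}}\preceq\mathcal{H}$ such that: (i) for every $K\in\mathcal{K}_{\mathcal{H}}$ and every $\mathcal{H}$-sequence $\mathfrak{X}$, $K\ast\mathfrak{X}\in(\mathcal{K}_{\mathcal{H}})^{|\mathfrak{X}|\ast}$; (ii) for every $K\in\mathcal{K}_{\mathcal{H}}$ and every $x\in K$, there exists an $\mathcal{H}$-augmenting sequence $\mathfrak{X}$ with $x\ast\mathfrak{X}=K$; (iii) for every $K\in\mathcal{K}_{\mathcal{H}}$, every $x\in K$ and every $\mathcal{H}$-augmenting sequence $\mathfrak{X}'$, $x\ast\mathfrak{X}'\subset K$. Moreover, $(\mathcal{K}_{\mathcal{H}})^{l\ast}=\mathcal{K}_{\mathcal{H}^{l\ast}}$ for all $l\geq 0$ (where $\mathcal{K}_{\mathcal{H}^{l\ast}}$ denotes the partition with the same properties for the stable partition $\mathcal{H}^{l\ast}$).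
   Context: All sets are finite. A binary operation $\ast$ on $\mathcal{X}$ is uniformity preserving if for every $b\in\mathcal{X}$ the map $x\mapsto x\ast b$ is a bijection of $\mathcal{X}$. For $A,B\subset\mathcal{X}$, $A\ast B=\{a\ast b: a\in A,b\in B\}$. For $a,b\in\mathcal{X}$ and $l>0$, $a$ is $\ast$-connectable to $b$ in $l$ steps if there exist $x_0,\dots,x_{l-1}\in\mathcal{X}$ with $(\cdots((a\ast x_0)\ast x_1)\cdots)\ast x_{l-1}=b$. A uniformity preserving $\ast$ is ergodic if there is $l>0$ such that every element is $\ast$-connectable to every element in $l$ steps. For a set $\mathcal{H}$ of subsets of $\mathcal{X}$, $\mathcal{H}^{\ast}=\{A\ast B: A,B\in\mathcal{H}\}$, $\mathcal{H}^{0\ast}=\mathcal{H}$, $\mathcal{H}^{n\ast}=(\mathcal{H}^{(n-1)\ast})^{\ast}$. A partition $\mathcal{H}$ of $\mathcal{X}$ is periodic if $\mathcal{H}^{n\ast}=\mathcal{H}$ for some $n>0$; the least such $n$ is $\mathrm{per}(\mathcal{H})$. It is balanced if all its blocks have the same size, and stable if it is balanced and periodic. For sets of subsets, $\mathcal{A}\preceq\mathcal{B}$ means every element of $\mathcal{A}$ is contained in some element of $\mathcal{B}$. For a finite sequence $\mathfrak{X}=(X_0,\dots,X_{k-1})$ of subsets of $\mathcal{X}$, $|\mathfrak{X}|=k$ and $A\ast\mathfrak{X}=(\cdots((A\ast X_0)\ast X_1)\cdots)\ast X_{k-1}$ for $A\subset\mathcal{X}$ ($x\ast\mathfrak{X}$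 means $\{x\}\ast\mathfrak{X}$). $\mathfrak{X}$ is an $\mathcal{H}$-sequence if $X_i\in\mathcal{H}^{i\ast}$ for all $0\le i<k$; it is $\mathcal{H}$-repeatable if moreover $\mathrm{per}(\mathcal{H})$ divides $k$; it is $\mathcal{H}$-augmenting if it is $\mathcal{H}$-repeatable and $A\subset A\ast\mathfrak{X}$ for all $A\subset\mathcal{X}$. -}

module Defs where

open import Data.Nat using (ℕ; zero; suc; _<_; _≤_)
open import Data.Nat.Divisibility using (_∣_)
open import Data.Fin using (Fin; toℕ)
import Data.Fin as Fin
open import Data.Fin.Properties using (_≟_)
open import Data.Fin.Subset using (Subset; _∈_; _⊆_; ⁅_⁆; ∣_∣; Nonempty; _∩_)
open import Data.Bool using (Bool; true; false; _∧_; _∨_)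
open import Data.Vec using (Vec; tabulate; lookup)
import Data.Vec as Vec
open import Data.List using (List; foldl; length)
import Data.List as List
open import Data.Product using (Σ; ∃; ∃-syntax; _×_; _,_)
open import Relation.Nullary using (does)
open import Relation.Binary.PropositionalEquality using (_≡_)
open import Function.Definitions using (Bijective)

-- The finite set 𝒳 is modelled as Fin n; a binary operation is Op n.
Op : ℕ → Set
Op n = Fin n → Fin n → Fin n

anyᶠ : ∀ {m} → (Fin m → Bool) → Bool
anyᶠ {zero}  f = false
anyᶠ {suc m} f = f Fin.zero ∨ anyᶠ (λ i → f (Fin.suc i))

module _ {n : ℕ} (_*_ : Op n) where

  _⊛_ : Subset n → Subset n → Subset n
  A ⊛ B = tabulate λ z → anyᶠ λ x → anyᶠ λ y →
            (lookup A x ∧ lookup B y) ∧ does ((x * y) ≟ z)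

  _⊛*_ : Subset n → List (Subset n) → Subset n
  A ⊛* 𝔛 = foldl _⊛_ A 𝔛

  UniformityPreserving : Set
  UniformityPreserving = ∀ (b : Fin n) → Bijective _≡_ _≡_ (λ x → x * b)

  Connectable : ℕ → Fin n → Fin n → Set
  Connectable l a b = Σ (Vec (Fin n) l) λ xs → Vec.foldl (λ _ → Fin n) _*_ a xs ≡ b

  Ergodic : Set
  Ergodic = UniformityPreserving × ∃[ l ] (0 < l × (∀ a b → Connectable l a b))

  Family : Set₁
  Family = Subset n → Set

  _≐_ : Family → Family → Set
  F ≐ G = ∀ A → (F A → G A) × (G A → F A)

  _⪯_ : Family → Family → Set
  F ⪯ G = ∀ A → F A → ∃[ B ] (G B × A ⊆ B)

  _^⋆ : Family → Family
  (F ^⋆) C = ∃[ A ] ∃[ B ] (F A × F B × C ≡ A ⊛ B)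

  pow : Family → ℕ → Family
  pow F zero    = F
  pow F (suc l) = (pow F l) ^⋆

  IsPartition : Family → Set
  IsPartition F = (∀ A → F A → Nonempty A)
                × (∀ x → ∃[ A ] (F A × x ∈ A))
                × (∀ A B → F A → F B → Nonempty (A ∩ B) → A ≡ B)

  IsBalanced : Family → Set
  IsBalanced F = ∀ A B → F A → F B → ∣ A ∣ ≡ ∣ B ∣

  IsPeriodic : Family → Set
  IsPeriodic F = ∃[ m ] (0 < m × pow F m ≐ F)

  IsPer : Family → ℕ → Set
  IsPer F p = 0 < p × pow F p ≐ F × (∀ m → 0 < m → pow F m ≐ F → p ≤ m)

  IsStable : Family → Set
  IsStable F = IsPartition F × IsBalanced F × IsPeriodic F

  IsSeq : Family → List (Subset n) → Set
  IsSeq F 𝔛 = ∀ (i : Fin (length 𝔛)) → pow F (toℕ i) (List.lookup 𝔛 i)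

  IsRepeatable : Family → List (Subset n) → Set
  IsRepeatable F 𝔛 = IsSeq F 𝔛 × ∃[ p ] (IsPer F p × p ∣ length 𝔛)

  IsAugmenting : Family → List (Subset n) → Set
  IsAugmenting F 𝔛 = IsRepeatable F 𝔛 × (∀ A → A ⊆ (A ⊛* 𝔛))

  IsKH : Family → Family → Set
  IsKH H K =
      IsStable K
    × K ⪯ H
    × (∀ C → K C → ∀ 𝔛 → IsSeq H 𝔛 → pow K (length 𝔛) (C ⊛* 𝔛))
    × (∀ C → K C → ∀ x → x ∈ C → ∃[ 𝔛 ] (IsAugmenting H 𝔛 × (⁅ x ⁆ ⊛* 𝔛) ≡ C))
    × (∀ C → K C → ∀ x → x ∈ C → ∀ 𝔛 → IsAugmenting H 𝔛 → (⁅ x ⁆ ⊛* 𝔛) ⊆ C)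

-- Since ∗ is uniformity preserving and ℋ is stable, all blocks of every ℋ^{i∗} have the same size, so a
-- product C ∗ D of two blocks is the translate C ∗ b for any b ∈ D. An ℋ-sequence therefore acts on sets like
-- a word whose i-th letter is determined only up to its block in ℋ^{i∗}. Put x ∼ y when there are two such
-- parallel words w, v of length divisible by p = per(ℋ), with w acting as the identity and x · v = y. Words
-- act by permutations of a finite set, so a power of a word inverts it, and ∼ is an equivalence relation; it is
-- decidable by a reachability search on pairs of points, and its classes are the blocks of 𝒦_ℋ. The blocks of
-- (𝒦_ℋ)^{k∗} are the translates K(x) · u with |u| = k, which gives stability and (i), while (ii) and (iii)
-- restate the definition of ∼ in terms of augmenting sequences and force uniqueness. Finally
-- K_{ℋ^{l∗}}(x · u) = K_ℋ(x) · u for |u| = l, whence (𝒦_ℋ)^{l∗} = 𝒦_{ℋ^{l∗}}.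

module Submission where

open import Defs
open import Data.Bool using (Bool; true; false; _∧_)
open import Data.Bool.Properties using () renaming (_≟_ to _≟ᵇ_)
open import Data.Fin using (Fin; toℕ; fromℕ<; combine; remQuot) renaming (zero to fzero; suc to fsuc)
import Data.Fin.Properties as FinP
open import Data.Fin.Subset using (Subset; _∈_; _⊆_; _∪_; ⁅_⁆; ∣_∣; Nonempty; inside; outside)
open import Data.Fin.Subset.Properties
  using (drop-∷-⊆; p⊆q⇒∣p∣≤∣q∣; ∣p∣≤n; ∣⁅x⁆∣≡1; ⊆-antisym; p⊆p∪q; x∈p∪q⁺; x∈p∪q⁻; x∈p∩q⁺; x∈p∩q⁻;
         x∈⁅x⁆; x∈⁅y⁆⇒x≡y; _∈?_)
open import Data.List using (List; []; _∷_; _++_; _∷ʳ_; foldl; length; map; take; drop; initLast; _∷ʳ′_)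
import Data.List as List
open import Data.List.Properties using (foldl-++; length-++; map-++; length-take; length-drop; take++drop≡id)
open import Data.List.Relation.Binary.Pointwise using (Pointwise; []; _∷_) renaming (++⁺ to ∈ʷ-++)
open import Data.List.Relation.Binary.Pointwise.Properties using (Pointwise-length)
open import Data.Nat as ℕ using (ℕ; zero; suc; _+_; _*_; _∸_; _<_; _≤_; z≤n; s≤s)
open import Data.Nat.Divisibility using (_∣_; divides; _∣0; ∣m∣n⇒∣m+n; ∣m+n∣m⇒∣n; ∣n⇒∣m*n; ∣m⇒∣m*n; n∣m*n; ∣-reflexive)
open import Data.Nat.Induction using (<-rec)
import Data.Nat.Properties as ℕP
open import Algebra.Properties.CommutativeSemigroup ℕP.+-commutativeSemigroup using (x∙yz≈y∙xz)
open import Data.Product using (∃; ∃₂; ∃-syntax; _×_; _,_; proj₁; proj₂)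
open import Data.Sum using (_⊎_; inj₁; inj₂)
open import Data.Vec using ([]; _∷_; tabulate; lookup; here; there)
import Data.Vec as Vec
import Data.Vec.Properties as VecP
open import Function using (_∘_; id)
open import Function.Definitions using (Injective)
open import Level using (0ℓ) renaming (suc to lsuc)
open import Relation.Binary.Bundles using (Setoid)
open import Relation.Binary.Construct.Closure.ReflexiveTransitive using (Star; ε; _◅_; _◅◅_; gmap)
open import Relation.Binary.PropositionalEquality
import Relation.Binary.Reasoning.Setoid as SetoidReasoning
open import Relation.Nullary using (Dec; yes; no; does; contradiction)
open import Relation.Nullary.Decidable using (_×-dec_)

∧≡true⁻ : ∀ {a b} → a ∧ b ≡ true → a ≡ true × b ≡ true
∧≡true⁻ {true} b≡true = refl , b≡true

does≡true⁻ : ∀ {p} {P : Set p} (P? : Dec P) → does P? ≡ true → P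
does≡true⁻ (yes p) _ = p

does≡true⁺ : ∀ {p} {P : Set p} (P? : Dec P) → P → does P? ≡ true
does≡true⁺ (yes _) _ = refl
does≡true⁺ (no ¬p) p = contradiction p ¬p

anyᶠ≡true⁻ : ∀ {m} (f : Fin m → Bool) → anyᶠ f ≡ true → ∃ λ i → f i ≡ true
anyᶠ≡true⁻ {suc m} f any≡true with f fzero in f0≡
... | true  = fzero , f0≡
... | false with anyᶠ≡true⁻ (f ∘ fsuc) any≡true
...   | i , fi≡true = fsuc i , fi≡true

anyᶠ≡true⁺ : ∀ {m} (f : Fin m → Bool) (i : Fin m) → f i ≡ true → anyᶠ f ≡ true
anyᶠ≡true⁺ f fzero    f0≡true rewrite f0≡true = refl
anyᶠ≡true⁺ f (fsuc i) fi≡true with f fzero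
... | true  = refl
... | false = anyᶠ≡true⁺ (f ∘ fsuc) i fi≡true

lookup⇒∈ : ∀ {m} {A : Subset m} {x} → lookup A x ≡ true → x ∈ A
lookup⇒∈ {A = A} {x} = VecP.lookup⇒[]= x A

∈⇒lookup : ∀ {m} {A : Subset m} {x} → x ∈ A → lookup A x ≡ true
∈⇒lookup = VecP.[]=⇒lookup

∈-tabulate⁻ : ∀ {m} {f : Fin m → Bool} {x} → x ∈ tabulate f → f x ≡ true
∈-tabulate⁻ {f = f} {x} x∈ = trans (sym (VecP.lookup∘tabulate f x)) (∈⇒lookup x∈)

∈-tabulate⁺ : ∀ {m} {f : Fin m → Bool} {x} → f x ≡ true → x ∈ tabulate f
∈-tabulate⁺ {f = f} {x} fx≡true = lookup⇒∈ (trans (VecP.lookup∘tabulate f x) fx≡true)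

least : (P : ℕ → Set) → (∀ k → Dec (P k)) → ∀ {m} → P m → ∃ λ p → P p × (∀ k → P k → p ≤ k)
least P P? {m} = <-rec (λ m → P m → Least) search m
  where
    Least = ∃ λ p → P p × (∀ k → P k → p ≤ k)
    search : ∀ m → (∀ {k} → k < m → P k → Least) → P m → Least
    search m rec pm with FinP.any? {n = m} (P? ∘ toℕ)
    ... | yes (k , pk) = rec (FinP.toℕ<n k) pk
    ... | no none      = m , pm , λ k pk → ℕP.≮⇒≥ λ k<m → none (fromℕ< k<m , subst P (sym (FinP.toℕ-fromℕ< k<m)) pk)

⊆∧∣q∣≤∣p∣⇒≡ : ∀ {m} {p q : Subset m} → p ⊆ q → ∣ q ∣ ≤ ∣ p ∣ → p ≡ q
⊆∧∣q∣≤∣p∣⇒≡ {p = []}          {[]}          _   _  = refl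
⊆∧∣q∣≤∣p∣⇒≡ {p = inside  ∷ p} {inside  ∷ q} p⊆q le = cong (inside ∷_) (⊆∧∣q∣≤∣p∣⇒≡ (drop-∷-⊆ p⊆q) (ℕP.≤-pred le))
⊆∧∣q∣≤∣p∣⇒≡ {p = outside ∷ p} {outside ∷ q} p⊆q le = cong (outside ∷_) (⊆∧∣q∣≤∣p∣⇒≡ (drop-∷-⊆ p⊆q) le)
⊆∧∣q∣≤∣p∣⇒≡ {p = outside ∷ p} {inside  ∷ q} p⊆q le = contradiction le (ℕP.<⇒≱ (s≤s (p⊆q⇒∣p∣≤∣q∣ (drop-∷-⊆ p⊆q))))
⊆∧∣q∣≤∣p∣⇒≡ {p = inside  ∷ p} {outside ∷ q} p⊆q le with () ← p⊆q here

remove : ∀ {m} → Subset m → Fin m → Subset m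
remove (_ ∷ p) fzero    = outside ∷ p
remove (b ∷ p) (fsuc x) = b ∷ remove p x

∣p∣≡1+∣remove∣ : ∀ {m} {p : Subset m} {x} → x ∈ p → ∣ p ∣ ≡ suc ∣ remove p x ∣
∣p∣≡1+∣remove∣ {p = inside  ∷ p} here       = refl
∣p∣≡1+∣remove∣ {p = inside  ∷ p} (there x∈) = cong suc (∣p∣≡1+∣remove∣ x∈)
∣p∣≡1+∣remove∣ {p = outside ∷ p} (there x∈) = ∣p∣≡1+∣remove∣ x∈

∈-remove⁺ : ∀ {m} {p : Subset m} {x y} → y ∈ p → y ≢ x → y ∈ remove p x
∈-remove⁺ {x = fzero}  {fzero}  _          y≢x = contradiction refl y≢x
∈-remove⁺ {x = fsuc x} {fzero}  here       _   = here
∈-remove⁺ {x = fzero}  {fsuc y} (there y∈) _   = there y∈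
∈-remove⁺ {x = fsuc x} {fsuc y} (there y∈) y≢x = there (∈-remove⁺ y∈ (y≢x ∘ cong fsuc))

∈-remove⁻ : ∀ {m} {p : Subset m} {x y} → y ∈ remove p x → y ∈ p × y ≢ x
∈-remove⁻ {p = _ ∷ p} {fzero}  {fsuc y} (there y∈) = there y∈ , λ ()
∈-remove⁻ {p = _ ∷ p} {fsuc x} {fzero}  here       = here , λ ()
∈-remove⁻ {p = _ ∷ p} {fsuc x} {fsuc y} (there y∈) with ∈-remove⁻ y∈
... | y∈p , y≢x = there y∈p , y≢x ∘ FinP.suc-injective

nonempty-of-size : ∀ {m} {p : Subset m} {k} → ∣ p ∣ ≡ suc k → ∃ λ x → x ∈ p
nonempty-of-size {p = inside  ∷ p} _ = fzero , here
nonempty-of-size {p = outside ∷ p} eq with nonempty-of-size {p = p} eq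
... | x , x∈ = fsuc x , there x∈

injective⇒∣p∣≤∣q∣ : ∀ {m m′} {p : Subset m} {q : Subset m′} (f : Fin m → Fin m′) →
                    Injective _≡_ _≡_ f → (∀ {x} → x ∈ p → f x ∈ q) → ∣ p ∣ ≤ ∣ q ∣
injective⇒∣p∣≤∣q∣ f inj f∈ = go _ refl f∈
  where
    go : ∀ {p} {q} k → ∣ p ∣ ≡ k → (∀ {x} → x ∈ p → f x ∈ q) → ∣ p ∣ ≤ ∣ q ∣
    go zero    ∣p∣≡0 _ rewrite ∣p∣≡0 = z≤n
    go {p} {q} (suc k) ∣p∣≡ f∈ with nonempty-of-size ∣p∣≡
    ... | x , x∈ = begin
      ∣ p ∣                          ≡⟨ ∣p∣≡1+∣remove∣ x∈ ⟩
      suc ∣ remove p x ∣             ≤⟨ s≤s (go k (ℕP.suc-injective (trans (sym (∣p∣≡1+∣remove∣ x∈)) ∣p∣≡)) f∈′) ⟩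
      suc ∣ remove q (f x) ∣         ≡⟨ sym (∣p∣≡1+∣remove∣ (f∈ x∈)) ⟩
      ∣ q ∣                          ∎
      where
        open ℕP.≤-Reasoning
        f∈′ : ∀ {y} → y ∈ remove p x → f y ∈ remove q (f x)
        f∈′ y∈ with ∈-remove⁻ y∈
        ... | y∈p , y≢x = ∈-remove⁺ (f∈ y∈p) (y≢x ∘ inj)

iterate : ∀ {A : Set} → (A → A) → ℕ → A → A
iterate f zero    = id
iterate f (suc k) = iterate f k ∘ f

iterate-+ : ∀ {A : Set} (f : A → A) a b z → iterate f (a + b) z ≡ iterate f b (iterate f a z)
iterate-+ f zero    b z = refl
iterate-+ f (suc a) b z = iterate-+ f a b (f z)

iterate-injective : ∀ {A : Set} {f : A → A} → Injective _≡_ _≡_ f → ∀ k → Injective _≡_ _≡_ (iterate f k)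
iterate-injective inj zero    eq = eq
iterate-injective inj (suc k) eq = inj (iterate-injective inj k eq)

iterate-*-fixed : ∀ {A : Set} (f : A → A) m {z} → iterate f m z ≡ z → ∀ k → iterate f (k * m) z ≡ z
iterate-*-fixed f m fixed zero    = refl
iterate-*-fixed f m {z} fixed (suc k) = begin
  iterate f (m + k * m) z          ≡⟨ iterate-+ f m (k * m) z ⟩
  iterate f (k * m) (iterate f m z) ≡⟨ cong (iterate f (k * m)) fixed ⟩
  iterate f (k * m) z              ≡⟨ iterate-*-fixed f m fixed k ⟩
  z                                ∎
  where open ≡-Reasoning

-- Pigeonhole on the orbit z, f z, f² z, …
injective⇒periodic-point : ∀ {m} {f : Fin m → Fin m} → Injective _≡_ _≡_ f → ∀ z → ∃ λ d → iterate f (suc d) z ≡ z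
injective⇒periodic-point {m} {f} inj z with FinP.pigeonhole (ℕP.n<1+n m) (λ i → iterate f (toℕ i) z)
... | i , j , i<j , fⁱz≡fʲz = d , iterate-injective inj (toℕ i) (begin
  iterate f (toℕ i) (iterate f (suc d) z) ≡⟨ sym (iterate-+ f (suc d) (toℕ i) z) ⟩
  iterate f (suc d + toℕ i) z             ≡⟨ cong (λ k → iterate f k z) d+i≡j ⟩
  iterate f (toℕ j) z                     ≡⟨ sym fⁱz≡fʲz ⟩
  iterate f (toℕ i) z                     ∎)
  where
    open ≡-Reasoning
    d = toℕ j ∸ suc (toℕ i)
    d+i≡j : suc d + toℕ i ≡ toℕ j
    d+i≡j = trans (ℕP.+-comm (suc d) (toℕ i)) (trans (ℕP.+-suc (toℕ i) d) (ℕP.m+[n∸m]≡n i<j))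

injective⇒periodic : ∀ {m} {f : Fin m → Fin m} → Injective _≡_ _≡_ f → ∃ λ M → ∀ z → iterate f (suc M) z ≡ z
injective⇒periodic {m} {f} inj = go m id
  where
    go : ∀ k (g : Fin k → Fin m) → ∃ λ M → ∀ i → iterate f (suc M) (g i) ≡ g i
    go zero    g = 0 , λ ()
    go (suc k) g with go k (g ∘ fsuc) | injective⇒periodic-point inj (g fzero)
    ... | M , hM | d , hd = d + M * suc d , fixed
      where
        fixed : ∀ i → iterate f (suc M * suc d) (g i) ≡ g i
        fixed fzero    = iterate-*-fixed f (suc d) hd (suc M)
        fixed (fsuc i) = trans (cong (λ k → iterate f k (g (fsuc i))) (ℕP.*-comm (suc M) (suc d)))
                               (iterate-*-fixed f (suc M) (hM i) (suc d))

module Reachability {N : ℕ} (R : Fin N → Fin N → Set) (R? : ∀ a b → Dec (R a b)) where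

  successors : Subset N → Subset N
  successors S = tabulate λ t → anyᶠ λ u → lookup S u ∧ does (R? u t)

  ∈-successors⁻ : ∀ {S t} → t ∈ successors S → ∃ λ u → u ∈ S × R u t
  ∈-successors⁻ {S} {t} t∈ with anyᶠ≡true⁻ _ (∈-tabulate⁻ t∈)
  ... | u , eq with ∧≡true⁻ eq
  ...   | u∈S , Rut = u , lookup⇒∈ u∈S , does≡true⁻ (R? u t) Rut

  ∈-successors⁺ : ∀ {S u t} → u ∈ S → R u t → t ∈ successors S
  ∈-successors⁺ {S} {u} {t} u∈ r = ∈-tabulate⁺ (anyᶠ≡true⁺ _ u
    (subst (λ b → b ∧ does (R? u t) ≡ true) (sym (∈⇒lookup u∈)) (does≡true⁺ (R? u t) r)))

  ball : Fin N → ℕ → Subset N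
  ball s zero    = ⁅ s ⁆
  ball s (suc k) = ball s k ∪ successors (ball s k)

  ball-sound : ∀ s k {t} → t ∈ ball s k → Star R s t
  ball-sound s zero    t∈ with refl ← x∈⁅y⁆⇒x≡y s t∈ = ε
  ball-sound s (suc k) t∈ with x∈p∪q⁻ (ball s k) _ t∈
  ... | inj₁ t∈ball = ball-sound s k t∈ball
  ... | inj₂ t∈succ with ∈-successors⁻ t∈succ
  ...   | u , u∈ , r = ball-sound s k u∈ ◅◅ (r ◅ ε)

  ball-⊆-+ : ∀ s m k → ball s k ⊆ ball s (m + k)
  ball-⊆-+ s zero    k t∈ = t∈
  ball-⊆-+ s (suc m) k t∈ = p⊆p∪q _ (ball-⊆-+ s m k t∈)

  ball-complete : ∀ s {u t} → Star R u t → ∀ k → u ∈ ball s k → ∃ λ m → t ∈ ball s (m + k)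
  ball-complete s ε       k u∈ = 0 , u∈
  ball-complete s {t = t} (r ◅ p) k u∈ with ball-complete s p (suc k) (x∈p∪q⁺ (inj₂ (∈-successors⁺ u∈ r)))
  ... | m , t∈ = suc m , subst (λ j → t ∈ ball s j) (ℕP.+-suc m k) t∈

  ball-grows-or-stops : ∀ s k → suc k ≤ ∣ ball s k ∣ ⊎ ball s k ≡ ball s (suc k)
  ball-grows-or-stops s zero    = inj₁ (ℕP.≤-reflexive (sym (∣⁅x⁆∣≡1 s)))
  ball-grows-or-stops s (suc k) with ball-grows-or-stops s k
  ... | inj₂ stops = inj₂ (cong (λ S → S ∪ successors S) stops)
  ... | inj₁ grows with ∣ ball s (suc k) ∣ ℕP.≤? ∣ ball s k ∣
  ...   | yes ≤∣ball∣ = inj₂ (cong (λ S → S ∪ successors S) (⊆∧∣q∣≤∣p∣⇒≡ (p⊆p∪q _) ≤∣ball∣))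
  ...   | no  ≰∣ball∣ = inj₁ (ℕP.≤-trans (s≤s grows) (ℕP.≰⇒> ≰∣ball∣))

  ball-stationary : ∀ s → ∀ m → ball s (m + N) ≡ ball s N
  ball-stationary s = go
    where
      stops : ball s N ≡ ball s (suc N)
      stops with ball-grows-or-stops s N
      ... | inj₁ grows = contradiction (∣p∣≤n (ball s N)) (ℕP.<⇒≱ grows)
      ... | inj₂ eq    = eq
      go : ∀ m → ball s (m + N) ≡ ball s N
      go zero    = refl
      go (suc m) = trans (cong (λ S → S ∪ successors S) (go m)) (sym stops)

  Star? : ∀ s t → Dec (Star R s t)
  Star? s t with t ∈? ball s N
  ... | yes t∈ = yes (ball-sound s N t∈)
  ... | no  t∉ = no λ path → t∉ (in-ball path)
    where
      in-ball : Star R s t → t ∈ ball s N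
      in-ball path with ball-complete s path 0 (x∈⁅x⁆ s)
      ... | m , t∈ = subst (t ∈_) (trans (cong (ball s) (ℕP.+-comm N (m + 0))) (ball-stationary s (m + 0)))
                       (ball-⊆-+ s N (m + 0) t∈)

module FiniteReachability {A : Set} {N : ℕ} (encode : A → Fin N) (decode : Fin N → A)
                          (decode∘encode : ∀ a → decode (encode a) ≡ a)
                          (R : A → A → Set) (R? : ∀ a b → Dec (R a b)) where

  open Reachability (λ i j → R (decode i) (decode j)) (λ i j → R? (decode i) (decode j))
    using () renaming (Star? to Star-decoded?)

  Star? : ∀ s t → Dec (Star R s t)
  Star? s t with Star-decoded? (encode s) (encode t)
  ... | yes path = yes (subst₂ (Star R) (decode∘encode s) (decode∘encode t) (gmap decode id path))
  ... | no ¬path = no λ path → ¬path (gmap encode (λ {a} {b} r → subst₂ R (sym (decode∘encode a)) (sym (decode∘encode b)) r) path)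

_^ʷ_ : ∀ {A : Set} → List A → ℕ → List A
w ^ʷ zero  = []
w ^ʷ suc k = w ++ w ^ʷ k

length-^ʷ : ∀ {A : Set} (w : List A) k → length (w ^ʷ k) ≡ k * length w
length-^ʷ w zero    = refl
length-^ʷ w (suc k) = trans (length-++ w) (cong (length w +_) (length-^ʷ w k))

module Words {n : ℕ} (_*_ : Op n) where

  infixl 6 _⊛′_ _·_ _·ˢ_
  infix  4 _∈ʷ_

  _⊛′_ : Subset n → Subset n → Subset n
  _⊛′_ = _⊛_ _*_

  ∈⊛⁻ : ∀ {A B z} → z ∈ A ⊛′ B → ∃₂ λ a b → a ∈ A × b ∈ B × a * b ≡ z
  ∈⊛⁻ {A} {B} {z} z∈ with anyᶠ≡true⁻ _ (∈-tabulate⁻ z∈)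
  ... | a , any-b with anyᶠ≡true⁻ _ any-b
  ...   | b , eq with ∧≡true⁻ eq
  ...     | a∈∧b∈ , ab≡z with ∧≡true⁻ a∈∧b∈
  ...       | a∈ , b∈ = a , b , lookup⇒∈ a∈ , lookup⇒∈ b∈ , does≡true⁻ ((a * b) FinP.≟ z) ab≡z

  ∈⊛⁺ : ∀ {A B a b} → a ∈ A → b ∈ B → a * b ∈ A ⊛′ B
  ∈⊛⁺ {A} {B} {a} {b} a∈ b∈ = ∈-tabulate⁺ (anyᶠ≡true⁺ _ a (anyᶠ≡true⁺ _ b
    (subst₂ (λ u v → (u ∧ v) ∧ _ ≡ _) (sym (∈⇒lookup a∈)) (sym (∈⇒lookup b∈))
            (does≡true⁺ ((a * b) FinP.≟ (a * b)) refl))))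

  _·_ : Fin n → List (Fin n) → Fin n
  x · w = foldl _*_ x w

  ·-++ : ∀ x u v → x · (u ++ v) ≡ (x · u) · v
  ·-++ = foldl-++ _*_

  _∈ʷ_ : List (Fin n) → List (Subset n) → Set
  _∈ʷ_ = Pointwise _∈_

  _⊛*′_ : Subset n → List (Subset n) → Subset n
  _⊛*′_ = _⊛*_ _*_

  ∈⊛*⁻ : ∀ 𝔛 {A z} → z ∈ A ⊛*′ 𝔛 → ∃₂ λ a w → a ∈ A × w ∈ʷ 𝔛 × a · w ≡ z
  ∈⊛*⁻ []      z∈ = _ , [] , z∈ , [] , refl
  ∈⊛*⁻ (X ∷ 𝔛) z∈ with ∈⊛*⁻ 𝔛 z∈
  ... | _ , w , a′∈ , w∈ , refl with ∈⊛⁻ a′∈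
  ...   | a , y , a∈ , y∈ , refl = a , y ∷ w , a∈ , y∈ ∷ w∈ , refl

  ∈⊛*⁺ : ∀ {𝔛 A a w} → a ∈ A → w ∈ʷ 𝔛 → a · w ∈ A ⊛*′ 𝔛
  ∈⊛*⁺ a∈ []          = a∈
  ∈⊛*⁺ a∈ (y∈ ∷ w∈)   = ∈⊛*⁺ (∈⊛⁺ a∈ y∈) w∈

  ⊛*-++ : ∀ A 𝔛 𝔜 → A ⊛*′ (𝔛 ++ 𝔜) ≡ (A ⊛*′ 𝔛) ⊛*′ 𝔜
  ⊛*-++ = foldl-++ (_⊛_ _*_)

  ⊛*-monoˡ : ∀ 𝔛 {A B} → A ⊆ B → A ⊛*′ 𝔛 ⊆ B ⊛*′ 𝔛
  ⊛*-monoˡ 𝔛 A⊆B z∈ with ∈⊛*⁻ 𝔛 z∈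
  ... | a , w , a∈ , w∈ , refl = ∈⊛*⁺ (A⊆B a∈) w∈

  _·ˢ_ : Subset n → List (Fin n) → Subset n
  A ·ˢ w = A ⊛*′ map ⁅_⁆ w

  ∈ʷ-singletons⁺ : ∀ w → w ∈ʷ map ⁅_⁆ w
  ∈ʷ-singletons⁺ []      = []
  ∈ʷ-singletons⁺ (y ∷ w) = x∈⁅x⁆ y ∷ ∈ʷ-singletons⁺ w

  ∈ʷ-singletons⁻ : ∀ {w w′} → w′ ∈ʷ map ⁅_⁆ w → w′ ≡ w
  ∈ʷ-singletons⁻ {[]}    []          = refl
  ∈ʷ-singletons⁻ {y ∷ w} (y′∈ ∷ w′∈) = cong₂ _∷_ (x∈⁅y⁆⇒x≡y y y′∈) (∈ʷ-singletons⁻ w′∈)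

  ∈·ˢ⁻ : ∀ {A} w {z} → z ∈ A ·ˢ w → ∃ λ a → a ∈ A × a · w ≡ z
  ∈·ˢ⁻ w z∈ with ∈⊛*⁻ (map ⁅_⁆ w) z∈
  ... | a , w′ , a∈ , w′∈ , eq with refl ← ∈ʷ-singletons⁻ w′∈ = a , a∈ , eq

  ∈·ˢ⁺ : ∀ {A a} w → a ∈ A → a · w ∈ A ·ˢ w
  ∈·ˢ⁺ w a∈ = ∈⊛*⁺ a∈ (∈ʷ-singletons⁺ w)

  ·ˢ-++ : ∀ A u v → A ·ˢ (u ++ v) ≡ (A ·ˢ u) ·ˢ v
  ·ˢ-++ A u v = trans (cong (A ⊛*′_) (map-++ ⁅_⁆ u v)) (⊛*-++ A (map ⁅_⁆ u) (map ⁅_⁆ v))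

  ·-^ʷ : ∀ w k z → z · (w ^ʷ k) ≡ iterate (_· w) k z
  ·-^ʷ w zero    z = refl
  ·-^ʷ w (suc k) z = trans (·-++ z w (w ^ʷ k)) (·-^ʷ w k (z · w))

module Translations {n : ℕ} (_*_ : Op n) (up : UniformityPreserving _*_) where
  open Words _*_

  *-cancelʳ : ∀ {b} → Injective _≡_ _≡_ (_* b)
  *-cancelʳ {b} = proj₁ (up b)

  _/_ : Fin n → Fin n → Fin n
  z / b = proj₁ (proj₂ (up b) z)

  /-* : ∀ z b → (z / b) * b ≡ z
  /-* z b = proj₂ (proj₂ (up b) z) refl

  *-/ : ∀ x b → (x * b) / b ≡ x
  *-/ x b = *-cancelʳ (/-* (x * b) b)

  ·-cancelʳ : ∀ w → Injective _≡_ _≡_ (_· w)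
  ·-cancelʳ []      eq = eq
  ·-cancelʳ (b ∷ w) eq = *-cancelʳ (·-cancelʳ w eq)

  record InverseWord (P : ℕ) (w : List (Fin n)) : Set where
    field
      exponent   : ℕ
      ·-inverseʳ : ∀ z → (z · w) · (w ^ʷ exponent) ≡ z
      ·-inverseˡ : ∀ z → (z · w ^ʷ exponent) · w ≡ z
      ∣length    : suc P ∣ length w + length (w ^ʷ exponent)

    inverse : List (Fin n)
    inverse = w ^ʷ exponent

  -- k + 1 is a multiple of suc P and of the order of the permutation (_· w)
  inverseWord : ∀ P w → InverseWord P w
  inverseWord P w with injective⇒periodic (·-cancelʳ w)
  ... | M , wᴹ⁺¹≡id = record
    { exponent   = k
    ; ·-inverseʳ = λ z → trans (sym (·-++ z w (w ^ʷ k))) (trans (·-^ʷ w (suc k) z) (w^[1+k]≡id z))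
    ; ·-inverseˡ = λ z → begin
        (z · w ^ʷ k) · w          ≡⟨ cong (_· w) (·-^ʷ w k z) ⟩
        iterate (_· w) k z · w    ≡⟨ sym (iterate-+ (_· w) k 1 z) ⟩
        iterate (_· w) (k + 1) z  ≡⟨ cong (λ j → iterate (_· w) j z) (ℕP.+-comm k 1) ⟩
        iterate (_· w) (suc k) z  ≡⟨ w^[1+k]≡id z ⟩
        z                         ∎
    ; ∣length    = subst (suc P ∣_) (sym (cong (length w +_) (length-^ʷ w k)))
                     (∣m⇒∣m*n (length w) (n∣m*n (suc M)))
    }
    where
      open ≡-Reasoning
      k = P + M ℕ.* suc P
      w^[1+k]≡id : ∀ z → iterate (_· w) (suc k) z ≡ z
      w^[1+k]≡id z = trans (cong (λ j → iterate (_· w) j z) (ℕP.*-comm (suc M) (suc P)))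
                           (iterate-*-fixed (_· w) (suc M) (wᴹ⁺¹≡id z) (suc P))

  ∣·ˢ[b]∣ : ∀ A b → ∣ A ·ˢ (b ∷ []) ∣ ≡ ∣ A ∣
  ∣·ˢ[b]∣ A b = ℕP.≤-antisym
    (injective⇒∣p∣≤∣q∣ (_/ b) (λ {x} {y} eq → trans (sym (/-* x b)) (trans (cong (_* b) eq) (/-* y b))) /b∈A)
    (injective⇒∣p∣≤∣q∣ {p = A} (_* b) *-cancelʳ (∈·ˢ⁺ (b ∷ [])))
    where
      /b∈A : ∀ {z} → z ∈ A ·ˢ (b ∷ []) → z / b ∈ A
      /b∈A z∈ with ∈·ˢ⁻ (b ∷ []) z∈
      ... | a , a∈ , refl = subst (_∈ A) (sym (*-/ a b)) a∈

  ∣·ˢ∣ : ∀ A w → ∣ A ·ˢ w ∣ ≡ ∣ A ∣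
  ∣·ˢ∣ A []      = refl
  ∣·ˢ∣ A (b ∷ w) = trans (cong ∣_∣ (·ˢ-++ A (b ∷ []) w)) (trans (∣·ˢ∣ (A ·ˢ (b ∷ [])) w) (∣·ˢ[b]∣ A b))

module Families {n : ℕ} (_*_ : Op n) where

  infix 4 _≐′_
  _≐′_ : Family _*_ → Family _*_ → Set
  _≐′_ = _≐_ _*_

  ≐-refl : ∀ {F} → F ≐′ F
  ≐-refl A = id , id

  ≐-sym : ∀ {F G} → F ≐′ G → G ≐′ F
  ≐-sym F≐G A = proj₂ (F≐G A) , proj₁ (F≐G A)

  ≐-trans : ∀ {F G H} → F ≐′ G → G ≐′ H → F ≐′ H
  ≐-trans F≐G G≐H A = proj₁ (G≐H A) ∘ proj₁ (F≐G A) , proj₂ (F≐G A) ∘ proj₂ (G≐H A)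

  ≡⇒≐ : ∀ {F G} → F ≡ G → F ≐′ G
  ≡⇒≐ refl = ≐-refl

  ≐-setoid : Setoid (lsuc 0ℓ) 0ℓ
  ≐-setoid = record
    { Carrier       = Family _*_
    ; _≈_           = _≐′_
    ; isEquivalence = record { refl = ≐-refl ; sym = ≐-sym ; trans = ≐-trans }
    }

  module ≐-Reasoning = SetoidReasoning ≐-setoid

  ^⋆-cong : ∀ {F G} → F ≐′ G → _^⋆ _*_ F ≐′ _^⋆ _*_ G
  ^⋆-cong F≐G C = (λ (A , B , FA , FB , eq) → A , B , proj₁ (F≐G A) FA , proj₁ (F≐G B) FB , eq)
                , (λ (A , B , GA , GB , eq) → A , B , proj₂ (F≐G A) GA , proj₂ (F≐G B) GB , eq)

  pow-cong : ∀ {F G} → F ≐′ G → ∀ k → pow _*_ F k ≐′ pow _*_ G k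
  pow-cong F≐G zero    = F≐G
  pow-cong F≐G (suc k) = ^⋆-cong (pow-cong F≐G k)

  pow-pow : ∀ F a b → pow _*_ (pow _*_ F a) b ≡ pow _*_ F (b + a)
  pow-pow F a zero    = refl
  pow-pow F a (suc b) = cong (_^⋆ _*_) (pow-pow F a b)

  pow-comm : ∀ F a b → pow _*_ (pow _*_ F a) b ≐′ pow _*_ (pow _*_ F b) a
  pow-comm F a b = ≡⇒≐ (trans (pow-pow F a b) (trans (cong (pow _*_ F) (ℕP.+-comm b a)) (sym (pow-pow F b a))))

  pow-*-periodic : ∀ F m → pow _*_ F m ≐′ F → ∀ k → pow _*_ F (k ℕ.* m) ≐′ F
  pow-*-periodic F m per zero    = ≐-refl
  pow-*-periodic F m per (suc k) =
    ≐-trans (≡⇒≐ (sym (pow-pow F (k ℕ.* m) m))) (≐-trans (pow-cong (pow-*-periodic F m per k) m) per)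

  pow-+-periodic : ∀ F m → pow _*_ F m ≐′ F → ∀ i k → pow _*_ F (i + k ℕ.* m) ≐′ pow _*_ F i
  pow-+-periodic F m per i k = ≐-trans (≡⇒≐ (sym (pow-pow F (k ℕ.* m) i))) (pow-cong (pow-*-periodic F m per k) i)

  data SequenceFrom (F : Family _*_) : ℕ → List (Subset n) → Set where
    []  : ∀ {i} → SequenceFrom F i []
    _∷_ : ∀ {i X 𝔛} → pow _*_ F i X → SequenceFrom F (suc i) 𝔛 → SequenceFrom F i (X ∷ 𝔛)

  IsSeq⇒SequenceFrom : ∀ {F} 𝔛 → IsSeq _*_ F 𝔛 → SequenceFrom F 0 𝔛
  IsSeq⇒SequenceFrom {F} 𝔛 seq = go 0 𝔛 seq
    where
      go : ∀ i 𝔛 → (∀ j → pow _*_ F (i + toℕ j) (List.lookup 𝔛 j)) → SequenceFrom F i 𝔛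
      go i []      _   = []
      go i (X ∷ 𝔛) seq = subst (λ k → pow _*_ F k X) (ℕP.+-identityʳ i) (seq fzero)
                       ∷ go (suc i) 𝔛 (λ j → subst (λ k → pow _*_ F k (List.lookup 𝔛 j)) (ℕP.+-suc i (toℕ j)) (seq (fsuc j)))

  SequenceFrom⇒IsSeq : ∀ {F} 𝔛 → SequenceFrom F 0 𝔛 → IsSeq _*_ F 𝔛
  SequenceFrom⇒IsSeq {F} 𝔛 = go 0 𝔛
    where
      go : ∀ i 𝔛 → SequenceFrom F i 𝔛 → ∀ j → pow _*_ F (i + toℕ j) (List.lookup 𝔛 j)
      go i (X ∷ 𝔛) (FX ∷ _)   fzero    = subst (λ k → pow _*_ F k X) (sym (ℕP.+-identityʳ i)) FX
      go i (X ∷ 𝔛) (_  ∷ seq) (fsuc j) = subst (λ k → pow _*_ F k (List.lookup 𝔛 j)) (sym (ℕP.+-suc i (toℕ j))) (go (suc i) 𝔛 seq j)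

  SequenceFrom-++ : ∀ {F i 𝔛 𝔜} → SequenceFrom F i 𝔛 → SequenceFrom F (length 𝔛 + i) 𝔜 → SequenceFrom F i (𝔛 ++ 𝔜)
  SequenceFrom-++             []         seq′ = seq′
  SequenceFrom-++ {F} {i} {_ ∷ 𝔛} {𝔜} (FX ∷ seq) seq′ =
    FX ∷ SequenceFrom-++ seq (subst (λ k → SequenceFrom F k 𝔜) (sym (ℕP.+-suc (length 𝔛) i)) seq′)

module PowersOfStable {n : ℕ} (_*_ : Op n) (up : UniformityPreserving _*_)
                      (F : Family _*_) (stable : IsStable _*_ F) where
  open Words _*_
  open Translations _*_ up
  open Families _*_

  private
    F-nonempty = proj₁ (proj₁ stable)
    F-covers   = proj₁ (proj₂ (proj₁ stable))
    F-disjoint = proj₂ (proj₂ (proj₁ stable))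
    F-balanced = proj₁ (proj₂ stable)

    some-period : ∃ λ q → pow _*_ F (suc q) ≐′ F
    some-period with proj₂ (proj₂ stable)
    ... | suc q , _ , per = q , per

    q = proj₁ some-period

    F-periodic : ∀ i → pow _*_ F (i ℕ.* suc q) ≐′ F
    F-periodic = pow-*-periodic F (suc q) (proj₂ some-period)

    i*q+i≡i*[1+q] : ∀ i → i ℕ.* q + i ≡ i ℕ.* suc q
    i*q+i≡i*[1+q] i = trans (ℕP.+-comm (i ℕ.* q) i) (sym (ℕP.*-suc i q))

    back-to-F : ∀ i {D} → pow _*_ F (i ℕ.* q + i) D → F D
    back-to-F i {D} FD = proj₁ (F-periodic i D) (subst (λ k → pow _*_ F k D) (i*q+i≡i*[1+q] i) FD)

  pow-covers : ∀ i x → ∃ λ C → pow _*_ F i C × x ∈ C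
  pow-covers zero    x = F-covers x
  pow-covers (suc i) x with pow-covers i (x / x) | pow-covers i x
  ... | C , FC , x/x∈ | D , FD , x∈ = C ⊛′ D , (C , D , FC , FD , refl) , subst (_∈ C ⊛′ D) (/-* x x) (∈⊛⁺ x/x∈ x∈)

  pow-nonempty : ∀ i {C} → pow _*_ F i C → Nonempty C
  pow-nonempty zero    FC = F-nonempty _ FC
  pow-nonempty (suc i) (A , B , FA , FB , refl) with pow-nonempty i FA | pow-nonempty i FB
  ... | a , a∈ | b , b∈ = a * b , ∈⊛⁺ a∈ b∈

  ·ˢ[b]⊆⊛ : ∀ {C D b} → b ∈ D → C ·ˢ (b ∷ []) ⊆ C ⊛′ D
  ·ˢ[b]⊆⊛ {C} {D} {b} b∈ z∈ with ∈·ˢ⁻ {C} (b ∷ []) z∈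
  ... | a , a∈ , refl = ∈⊛⁺ {C} {D} a∈ b∈

  ∣C∣≤∣C⊛D∣ : ∀ i {C D} → pow _*_ F i D → ∣ C ∣ ≤ ∣ C ⊛′ D ∣
  ∣C∣≤∣C⊛D∣ i {C} FD with pow-nonempty i FD
  ... | b , b∈ = subst (_≤ _) (∣·ˢ[b]∣ C b) (p⊆q⇒∣p∣≤∣q∣ (·ˢ[b]⊆⊛ {C} b∈))

  ∣F∣≤∣pow∣ : ∀ i {A C} → F A → pow _*_ F i C → ∣ A ∣ ≤ ∣ C ∣
  ∣F∣≤∣pow∣ zero    FA FC = ℕP.≤-reflexive (F-balanced _ _ FA FC)
  ∣F∣≤∣pow∣ (suc i) FA (C , D , FC , FD , refl) = ℕP.≤-trans (∣F∣≤∣pow∣ i FA FC) (∣C∣≤∣C⊛D∣ i {C} FD)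

  grow : ∀ j i {C} → pow _*_ F i C → ∃ λ D → pow _*_ F (j + i) D × ∣ C ∣ ≤ ∣ D ∣
  grow zero    i {C} FC = C , FC , ℕP.≤-refl
  grow (suc j) i FC with grow j i FC
  ... | D , FD , ≤∣D∣ = D ⊛′ D , (D , D , FD , FD , refl) , ℕP.≤-trans ≤∣D∣ (∣C∣≤∣C⊛D∣ (j + i) {D} FD)

  ∣pow∣≤∣F∣ : ∀ i {A C} → F A → pow _*_ F i C → ∣ C ∣ ≤ ∣ A ∣
  ∣pow∣≤∣F∣ i {A} FA FC with grow (i ℕ.* q) i FC
  ... | D , FD , ≤∣D∣ = ℕP.≤-trans ≤∣D∣ (ℕP.≤-reflexive (F-balanced D A (back-to-F i FD) FA))

  ∣pow∣≡∣F∣ : ∀ i {A C} → F A → pow _*_ F i C → ∣ C ∣ ≡ ∣ A ∣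
  ∣pow∣≡∣F∣ i FA FC = ℕP.≤-antisym (∣pow∣≤∣F∣ i FA FC) (∣F∣≤∣pow∣ i FA FC)

  -- the key fact: a product of blocks is a translate, since both have the size of a block of F
  ⊛≡·ˢ : ∀ i {C D b} → pow _*_ F i C → pow _*_ F i D → b ∈ D → C ⊛′ D ≡ C ·ˢ (b ∷ [])
  ⊛≡·ˢ i {C} {D} {b} FC FD b∈ with F-covers b
  ... | A , FA , _ = sym (⊆∧∣q∣≤∣p∣⇒≡ (·ˢ[b]⊆⊛ {C} {D} b∈) (ℕP.≤-reflexive (begin
      ∣ C ⊛′ D ∣            ≡⟨ ∣pow∣≡∣F∣ (suc i) FA (C , D , FC , FD , refl) ⟩
      ∣ A ∣                 ≡⟨ sym (∣pow∣≡∣F∣ i FA FC) ⟩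
      ∣ C ∣                 ≡⟨ sym (∣·ˢ[b]∣ C b) ⟩
      ∣ C ·ˢ (b ∷ []) ∣     ∎)))
    where open ≡-Reasoning

  pow-·ˢ[b] : ∀ i {C} b → pow _*_ F i C → pow _*_ F (suc i) (C ·ˢ (b ∷ []))
  pow-·ˢ[b] i {C} b FC with pow-covers i b
  ... | D , FD , b∈ = subst (pow _*_ F (suc i)) (⊛≡·ˢ i FC FD b∈) (C , D , FC , FD , refl)

  pow-·ˢ : ∀ i {C} w → pow _*_ F i C → pow _*_ F (length w + i) (C ·ˢ w)
  pow-·ˢ i     []      FC = FC
  pow-·ˢ i {C} (b ∷ w) FC = subst₂ (pow _*_ F) (ℕP.+-suc (length w) i) (sym (·ˢ-++ C (b ∷ []) w))
                                   (pow-·ˢ (suc i) w (pow-·ˢ[b] i b FC))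

  ·ˢ-cancelʳ : ∀ w {C C′} → C ·ˢ w ≡ C′ ·ˢ w → C ⊆ C′
  ·ˢ-cancelʳ w {C} {C′} eq {x} x∈ with ∈·ˢ⁻ w (subst (x · w ∈_) eq (∈·ˢ⁺ w x∈))
  ... | x′ , x′∈ , x′w≡xw = subst (_∈ C′) (·-cancelʳ w x′w≡xw) x′∈

  -- translating by z^{i·q} carries blocks of F^{i∗} into F, where disjointness is known
  pow-disjoint : ∀ i {C C′ z} → pow _*_ F i C → pow _*_ F i C′ → z ∈ C → z ∈ C′ → C ≡ C′
  pow-disjoint i {C} {C′} {z} FC FC′ z∈ z∈′ = ⊆-antisym (·ˢ-cancelʳ t eq) (·ˢ-cancelʳ t (sym eq))
    where
      t = (z ∷ []) ^ʷ (i ℕ.* q)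
      |t|+i≡ : length t + i ≡ i ℕ.* q + i
      |t|+i≡ = cong (_+ i) (trans (length-^ʷ (z ∷ []) (i ℕ.* q)) (ℕP.*-identityʳ (i ℕ.* q)))
      F-·ˢt : ∀ {D} → pow _*_ F i D → F (D ·ˢ t)
      F-·ˢt {D} FD = back-to-F i (subst (λ k → pow _*_ F k (D ·ˢ t)) |t|+i≡ (pow-·ˢ i t FD))
      eq : C ·ˢ t ≡ C′ ·ˢ t
      eq = F-disjoint _ _ (F-·ˢt FC) (F-·ˢt FC′) (z · t , x∈p∩q⁺ (∈·ˢ⁺ t z∈ , ∈·ˢ⁺ t z∈′))

  pow-periodic : ∀ i m → pow _*_ F m ≐′ F → pow _*_ (pow _*_ F i) m ≐′ pow _*_ F i
  pow-periodic i m per = ≐-trans (pow-comm F i m) (pow-cong per i)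

  -- opaque so that modules instantiated with pow-stable i never unfold its proof
  opaque
    pow-stable : ∀ i → IsStable _*_ (pow _*_ F i)
    pow-stable i = ( (λ _ → pow-nonempty i)
                   , pow-covers i
                   , (λ A B FA FB (z , z∈) → pow-disjoint i FA FB (proj₁ (x∈p∩q⁻ A B z∈)) (proj₂ (x∈p∩q⁻ A B z∈))))
                 , balanced
                 , suc q , s≤s z≤n , pow-periodic i (suc q) (proj₂ some-period)
      where
        balanced : IsBalanced _*_ (pow _*_ F i)
        balanced A B FA FB with pow-nonempty i FA
        ... | y , _ with F-covers y
        ...   | A₀ , FA₀ , _ = trans (∣pow∣≡∣F∣ i FA₀ FA) (sym (∣pow∣≡∣F∣ i FA₀ FB))

  block : ℕ → Fin n → Subset n
  block i x = proj₁ (pow-covers i x)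

  pow-block : ∀ i x → pow _*_ F i (block i x)
  pow-block i x = proj₁ (proj₂ (pow-covers i x))

  ∈-block : ∀ i x → x ∈ block i x
  ∈-block i x = proj₂ (proj₂ (pow-covers i x))

  block-unique : ∀ i {C x} → pow _*_ F i C → x ∈ C → C ≡ block i x
  block-unique i FC x∈ = pow-disjoint i FC (pow-block i _) x∈ (∈-block i _)

  record SameBlock (i : ℕ) (y y′ : Fin n) : Set where
    constructor sameBlock
    field
      {common} : Subset n
      pow-common : pow _*_ F i common
      ∈-common   : y ∈ common
      ∈-common′  : y′ ∈ common

  SameBlock? : ∀ i y y′ → Dec (SameBlock i y y′)
  SameBlock? i y y′ with y′ ∈? block i y
  ... | yes y′∈ = yes (sameBlock (pow-block i y) (∈-block i y) y′∈)
  ... | no  y′∉ = no λ (sameBlock FC y∈ y′∈) → y′∉ (subst (y′ ∈_) (block-unique i FC y∈) y′∈)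

  SameBlock-refl : ∀ i y → SameBlock i y y
  SameBlock-refl i y = sameBlock (pow-block i y) (∈-block i y) (∈-block i y)

  ·ˢ-SameBlock : ∀ i {C y y′} → pow _*_ F i C → SameBlock i y y′ → C ·ˢ (y ∷ []) ≡ C ·ˢ (y′ ∷ [])
  ·ˢ-SameBlock i FC (sameBlock FB y∈ y′∈) = trans (sym (⊛≡·ˢ i FC FB y∈)) (⊛≡·ˢ i FC FB y′∈)

  -- a partition is determined by its blocks at each point
  pow≐? : ∀ m → Dec (pow _*_ F m ≐′ F)
  pow≐? m with FinP.all? (λ y → VecP.≡-dec _≟ᵇ_ (block m y) (block 0 y))
  ... | yes same = yes λ C → to C , from C
    where
      to : ∀ C → pow _*_ F m C → F C
      to C FC with pow-nonempty m FC
      ... | y , y∈ = subst F (sym (trans (block-unique m FC y∈) (same y))) (pow-block 0 y)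
      from : ∀ C → F C → pow _*_ F m C
      from C FC with pow-nonempty 0 FC
      ... | y , y∈ = subst (pow _*_ F m) (sym (trans (block-unique 0 FC y∈) (sym (same y)))) (pow-block m y)
  ... | no ¬same = no λ per → ¬same λ y → block-unique 0 (proj₁ (per _) (pow-block m y)) (∈-block m y)

  period : ∃ λ p → IsPer _*_ F p
  period with least (λ k → pow _*_ F (suc k) ≐′ F) (pow≐? ∘ suc) {q} (proj₂ some-period)
  ... | p , per , minimal = suc p , s≤s z≤n , per , λ { (suc k) _ per′ → s≤s (minimal k per′) }

  -- periods of F^{l∗} are periods of F: compose with F^{(l·q)∗}, which is F
  periodic-unpow : ∀ l m → pow _*_ (pow _*_ F l) m ≐′ pow _*_ F l → pow _*_ F m ≐′ F
  periodic-unpow l m per = begin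
    pow _*_ F m                                       ≈⟨ pow-cong F≐pow m ⟩
    pow _*_ (pow _*_ F (r + l)) m                     ≈⟨ pow-cong (≡⇒≐ (sym (pow-pow F l r))) m ⟩
    pow _*_ (pow _*_ (pow _*_ F l) r) m               ≈⟨ pow-comm (pow _*_ F l) r m ⟩
    pow _*_ (pow _*_ (pow _*_ F l) m) r               ≈⟨ pow-cong per r ⟩
    pow _*_ (pow _*_ F l) r                           ≈⟨ ≡⇒≐ (pow-pow F l r) ⟩
    pow _*_ F (r + l)                                 ≈⟨ ≐-sym F≐pow ⟩
    F                                                 ∎
    where
      r = l ℕ.* q
      F≐pow : F ≐′ pow _*_ F (r + l)
      F≐pow D = (λ FD → subst (λ k → pow _*_ F k D) (sym (i*q+i≡i*[1+q] l)) (proj₂ (F-periodic l D) FD)) , back-to-F l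
      open ≐-Reasoning

  IsPer-pow : ∀ l p → IsPer _*_ F p → IsPer _*_ (pow _*_ F l) p
  IsPer-pow l p (p>0 , per , minimal) = p>0 , pow-periodic l p per , λ m m>0 per′ → minimal m m>0 (periodic-unpow l m per′)

module Linking {n : ℕ} (_*_ : Op n) (up : UniformityPreserving _*_) (F : Family _*_) (stable : IsStable _*_ F)
               (P : ℕ) (per : IsPer _*_ F (suc P)) where
  open Words _*_
  open Translations _*_ up
  open Families _*_
  open PowersOfStable _*_ up F stable public

  p : ℕ
  p = suc P

  F-periodic : pow _*_ F p ≐′ F
  F-periodic = proj₁ (proj₂ per)

  ∣length-++ : ∀ {w w′ : List (Fin n)} → p ∣ length w → p ∣ length w′ → p ∣ length (w ++ w′)
  ∣length-++ {w} d d′ = subst (p ∣_) (sym (length-++ w)) (∣m∣n⇒∣m+n d d′)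

  SameBlock-period⁺ : ∀ {i j y y′} → p ∣ j → SameBlock i y y′ → SameBlock (j + i) y y′
  SameBlock-period⁺ {i} (divides c refl) (sameBlock {C} FC y∈ y′∈) =
    sameBlock (subst (λ k → pow _*_ F k C) (ℕP.+-comm i (c ℕ.* p)) (proj₂ (pow-+-periodic F p F-periodic i c C) FC)) y∈ y′∈

  SameBlock-period⁻ : ∀ {i j y y′} → p ∣ j → SameBlock (j + i) y y′ → SameBlock i y y′
  SameBlock-period⁻ {i} (divides c refl) (sameBlock {C} FC y∈ y′∈) =
    sameBlock (proj₁ (pow-+-periodic F p F-periodic i c C) (subst (λ k → pow _*_ F k C) (ℕP.+-comm (c ℕ.* p) i) FC)) y∈ y′∈

  data Parallel : ℕ → List (Fin n) → List (Fin n) → Set where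
    []  : ∀ {i} → Parallel i [] []
    _∷_ : ∀ {i y y′ w v} → SameBlock i y y′ → Parallel (suc i) w v → Parallel i (y ∷ w) (y′ ∷ v)

  Parallel-period⁺ : ∀ {i j w v} → p ∣ j → Parallel i w v → Parallel (j + i) w v
  Parallel-period⁺ d [] = []
  Parallel-period⁺ {i} {j} d (_∷_ {w = w} {v} s r) =
    SameBlock-period⁺ d s ∷ subst (λ k → Parallel k w v) (ℕP.+-suc j i) (Parallel-period⁺ d r)

  Parallel-period⁻ : ∀ {i j w v} → p ∣ j → Parallel (j + i) w v → Parallel i w v
  Parallel-period⁻ {w = []}    {[]}    d []      = []
  Parallel-period⁻ {i} {j} {_ ∷ w} {_ ∷ v} d (s ∷ r) =
    SameBlock-period⁻ d s ∷ Parallel-period⁻ d (subst (λ k → Parallel k w v) (sym (ℕP.+-suc j i)) r)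

  Parallel-refl : ∀ i w → Parallel i w w
  Parallel-refl i []      = []
  Parallel-refl i (y ∷ w) = SameBlock-refl i y ∷ Parallel-refl (suc i) w

  Parallel-++ : ∀ {i w v w′ v′} → Parallel i w v → Parallel (length w + i) w′ v′ → Parallel i (w ++ w′) (v ++ v′)
  Parallel-++ [] r′ = r′
  Parallel-++ {i} {_ ∷ w} {w′ = w′} {v′} (s ∷ r) r′ = s ∷ Parallel-++ r (subst (λ k → Parallel k w′ v′) (sym (ℕP.+-suc (length w) i)) r′)

  Parallel-take : ∀ {i w v} k → Parallel i w v → Parallel i (take k w) (take k v)
  Parallel-take zero    r       = []
  Parallel-take (suc k) []      = []
  Parallel-take (suc k) (s ∷ r) = s ∷ Parallel-take k r

  Parallel-drop : ∀ {i w v} k → Parallel i w v → Parallel (k + i) (drop k w) (drop k v)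
  Parallel-drop zero    r       = r
  Parallel-drop (suc k) []      = []
  Parallel-drop {i} {_ ∷ w} {_ ∷ v} (suc k) (s ∷ r) = subst (λ j → Parallel j (drop k w) (drop k v)) (ℕP.+-suc k i) (Parallel-drop k r)

  ∈ʷ⇒Parallel : ∀ {i 𝔛 w v} → SequenceFrom F i 𝔛 → w ∈ʷ 𝔛 → v ∈ʷ 𝔛 → Parallel i w v
  ∈ʷ⇒Parallel []         []          []          = []
  ∈ʷ⇒Parallel (FX ∷ seq) (y∈ ∷ w∈)   (y′∈ ∷ v∈)  = sameBlock FX y∈ y′∈ ∷ ∈ʷ⇒Parallel seq w∈ v∈

  Parallel⇒∈ʷ : ∀ {i w v} → Parallel i w v → ∃ λ 𝔛 → SequenceFrom F i 𝔛 × w ∈ʷ 𝔛 × v ∈ʷ 𝔛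
  Parallel⇒∈ʷ []                            = [] , [] , [] , []
  Parallel⇒∈ʷ (sameBlock FB y∈ y′∈ ∷ r) with Parallel⇒∈ʷ r
  ... | 𝔛 , seq , w∈ , v∈ = _ ∷ 𝔛 , FB ∷ seq , y∈ ∷ w∈ , y′∈ ∷ v∈

  SequenceFrom-period⁺ : ∀ {i j 𝔛} → p ∣ j → SequenceFrom F i 𝔛 → SequenceFrom F (j + i) 𝔛
  SequenceFrom-period⁺ d [] = []
  SequenceFrom-period⁺ {i} {j} d@(divides c refl) (_∷_ {X = X} {𝔛} FX seq) =
    subst (λ k → pow _*_ F k X) (ℕP.+-comm i (c ℕ.* p)) (proj₂ (pow-+-periodic F p F-periodic i c X) FX)
    ∷ subst (λ k → SequenceFrom F k 𝔛) (ℕP.+-suc j i) (SequenceFrom-period⁺ d seq)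

  ·ˢ-Parallel : ∀ i {C w v} → pow _*_ F i C → Parallel i w v → C ·ˢ w ≡ C ·ˢ v
  ·ˢ-Parallel i FC [] = refl
  ·ˢ-Parallel i {C} {y ∷ w} {y′ ∷ v} FC (s ∷ r) = begin
    C ·ˢ (y ∷ w)                ≡⟨ ·ˢ-++ C (y ∷ []) w ⟩
    (C ·ˢ (y ∷ [])) ·ˢ w        ≡⟨ cong (_·ˢ w) (·ˢ-SameBlock i FC s) ⟩
    (C ·ˢ (y′ ∷ [])) ·ˢ w       ≡⟨ ·ˢ-Parallel (suc i) (pow-·ˢ[b] i y′ FC) r ⟩
    (C ·ˢ (y′ ∷ [])) ·ˢ v       ≡⟨ sym (·ˢ-++ C (y′ ∷ []) v) ⟩
    C ·ˢ (y′ ∷ v)               ∎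
    where open ≡-Reasoning

  Trivial : List (Fin n) → Set
  Trivial w = ∀ z → z · w ≡ z

  Trivial-++ : ∀ {w w′} → Trivial w → Trivial w′ → Trivial (w ++ w′)
  Trivial-++ {w} {w′} tw tw′ z = trans (·-++ z w w′) (trans (cong (_· w′) (tw z)) (tw′ z))

  Trivial-^ʷ : ∀ {w} → Trivial w → ∀ k → Trivial (w ^ʷ k)
  Trivial-^ʷ tw zero    z = refl
  Trivial-^ʷ {w} tw (suc k) z = Trivial-++ {w} {w ^ʷ k} tw (Trivial-^ʷ {w} tw k) z

  -- Parallel words w, v with p ∣ |w| spell a common F-repeatable sequence 𝔛; when w acts trivially,
  -- 𝔛 is augmenting, and x · v ranges over x ∗ 𝔛. In the weaker x ∼ₓ y, w need only fix x.
  infix 4 _∼_ _∼ₓ_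
  _∼_ : Fin n → Fin n → Set
  x ∼ y = ∃₂ λ w v → Parallel 0 w v × p ∣ length w × Trivial w × x · v ≡ y

  _∼ₓ_ : Fin n → Fin n → Set
  x ∼ₓ y = ∃₂ λ w v → Parallel 0 w v × p ∣ length w × x · w ≡ x × x · v ≡ y

  -- t ++ w acts trivially for the inverse word t of w, and x · t = x since x · w = x
  ∼ₓ⇒∼ : ∀ {x y} → x ∼ₓ y → x ∼ y
  ∼ₓ⇒∼ {x} {y} (w , v , r , p∣w , xw≡x , xv≡y) =
    t ++ w , t ++ v , Parallel-++ (Parallel-refl 0 t) (Parallel-period⁺ p∣t r) , ∣length-++ {t} p∣t p∣w ,
    (λ z → trans (·-++ z t w) (InverseWord.·-inverseˡ I z)) ,
    trans (·-++ x t v) (trans (cong (_· v) xt≡x) xv≡y)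
    where
      I = inverseWord P w
      t = InverseWord.inverse I
      p∣t : p ∣ length t
      p∣t = ∣m+n∣m⇒∣n (InverseWord.∣length I) p∣w
      xt≡x : x · t ≡ x
      xt≡x = trans (cong (_· t) (sym xw≡x)) (InverseWord.·-inverseʳ I x)

  ∼-refl : ∀ x → x ∼ x
  ∼-refl x = [] , [] , [] , (p ∣0) , (λ z → refl) , refl

  ∼-trans : ∀ {x y z} → x ∼ y → y ∼ z → x ∼ z
  ∼-trans {x} (w , v , r , d , tw , xv≡y) (w′ , v′ , r′ , d′ , tw′ , yv′≡z) =
    w ++ w′ , v ++ v′ , Parallel-++ r (Parallel-period⁺ d r′) , ∣length-++ {w} d d′ , Trivial-++ {w} {w′} tw tw′ ,
    trans (·-++ x v v′) (trans (cong (_· v′) xv≡y) yv′≡z)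

  Parallel-^ʷ : ∀ {w v} → Parallel 0 w v → p ∣ length w → ∀ k → Parallel 0 (w ^ʷ k) (v ^ʷ k)
  Parallel-^ʷ r d zero    = []
  Parallel-^ʷ r d (suc k) = Parallel-++ r (Parallel-period⁺ d (Parallel-^ʷ r d k))

  ∼-sym : ∀ {x y} → x ∼ y → y ∼ x
  ∼-sym {x} {y} (w , v , r , d , tw , xv≡y) =
    w ^ʷ k , v ^ʷ k , Parallel-^ʷ r d k , subst (p ∣_) (sym (length-^ʷ w k)) (∣n⇒∣m*n k d) , Trivial-^ʷ {w} tw k ,
    trans (cong (_· v ^ʷ k) (sym xv≡y)) (InverseWord.·-inverseʳ I x)
    where
      I = inverseWord P v
      k = InverseWord.exponent I

  Moves : ℕ → ℕ → Fin n → Fin n → Fin n → Fin n → Set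
  Moves i k a b a′ b′ = ∃₂ λ w v → Parallel i w v × length w ≡ k × a · w ≡ a′ × b · v ≡ b′

  Moves? : ∀ i k a b a′ b′ → Dec (Moves i k a b a′ b′)
  Moves? i zero a b a′ b′ with a FinP.≟ a′ | b FinP.≟ b′
  ... | yes a≡a′ | yes b≡b′ = yes ([] , [] , [] , refl , a≡a′ , b≡b′)
  ... | no  a≢a′ | _        = no λ { ([] , _ , [] , _ , a≡a′ , _) → a≢a′ a≡a′ }
  ... | yes _    | no  b≢b′ = no λ { ([] , _ , [] , _ , _ , b≡b′) → b≢b′ b≡b′ }
  Moves? i (suc k) a b a′ b′
    with FinP.any? (λ y → FinP.any? (λ y′ → SameBlock? i y y′ ×-dec Moves? (suc i) k (a * y) (b * y′) a′ b′))
  ... | yes (y , y′ , s , w , v , r , |w|≡k , eq , eq′) = yes (y ∷ w , y′ ∷ v , s ∷ r , cong suc |w|≡k , eq , eq′)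
  ... | no none = no λ { ((y ∷ w) , (y′ ∷ v) , (s ∷ r) , |w|≡ , eq , eq′) →
                           none (y , y′ , s , w , v , r , ℕP.suc-injective |w|≡ , eq , eq′) }

  Move : Fin n × Fin n → Fin n × Fin n → Set
  Move (a , b) (a′ , b′) = Moves 0 p a b a′ b′

  Star-Move⇒ : ∀ {a b a′ b′} → Star Move (a , b) (a′ , b′) →
               ∃₂ λ w v → Parallel 0 w v × p ∣ length w × a · w ≡ a′ × b · v ≡ b′
  Star-Move⇒ ε = [] , [] , [] , (p ∣0) , refl , refl
  Star-Move⇒ {a} {b} ((w , v , r , |w|≡p , refl , refl) ◅ moves) with Star-Move⇒ moves
  ... | w′ , v′ , r′ , d′ , eq , eq′ =
    w ++ w′ , v ++ v′ , Parallel-++ r (Parallel-period⁺ p∣w r′) , ∣length-++ {w} p∣w d′ ,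
    trans (·-++ a w w′) eq , trans (·-++ b v v′) eq′
    where
      p∣w : p ∣ length w
      p∣w = ∣-reflexive (sym |w|≡p)

  Star-Move⇐ : ∀ c {w v} → Parallel 0 w v → length w ≡ c ℕ.* p → ∀ a b → Star Move (a , b) (a · w , b · v)
  Star-Move⇐ zero    {[]}    []     _ a b = ε
  Star-Move⇐ (suc c) {w} {v} r |w|≡ a b =
    subst₂ (λ u u′ → Star Move (a , b) (u , u′)) (take-drop-· a w) (take-drop-· b v) (first ◅ rest)
    where
      p≤|w| : p ≤ length w
      p≤|w| = subst (p ≤_) (sym |w|≡) (ℕP.m≤m+n p (c ℕ.* p))
      first : Move (a , b) (a · take p w , b · take p v)
      first = take p w , take p v , Parallel-take p r , trans (length-take p w) (ℕP.m≤n⇒m⊓n≡m p≤|w|) , refl , refl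
      rest : Star Move (a · take p w , b · take p v) ((a · take p w) · drop p w , (b · take p v) · drop p v)
      rest = Star-Move⇐ c (Parallel-period⁻ {j = p} (∣-reflexive refl) (Parallel-drop p r))
               (trans (length-drop p w) (trans (cong (_∸ p) |w|≡) (ℕP.m+n∸m≡n p (c ℕ.* p)))) _ _
      take-drop-· : ∀ z u → (z · take p u) · drop p u ≡ z · u
      take-drop-· z u = trans (sym (·-++ z (take p u) (drop p u))) (cong (z ·_) (take++drop≡id p u))

  open FiniteReachability (λ (a , b) → combine a b) (remQuot n) (λ (a , b) → FinP.remQuot-combine a b)
                          Move (λ (a , b) (a′ , b′) → Moves? 0 p a b a′ b′)

  -- x ∼ y iff (x , x) reaches (x , y) by moves, a reachability question on Fin n × Fin n
  ∼? : ∀ x y → Dec (x ∼ y)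
  ∼? x y with Star? (x , x) (x , y)
  ... | yes moves = yes (∼ₓ⇒∼ (Star-Move⇒ moves))
  ... | no ¬moves = no λ (w , v , r , divides c |w|≡ , tw , xv≡y) →
          ¬moves (subst (λ u → Star Move (x , x) u) (cong₂ _,_ (tw x) xv≡y) (Star-Move⇐ c r |w|≡ x x))

module KPartition {n : ℕ} (_*_ : Op n) (ergodic : Ergodic _*_) (F : Family _*_) (stable : IsStable _*_ F)
                  (P : ℕ) (per : IsPer _*_ F (suc P)) where
  up : UniformityPreserving _*_
  up = proj₁ ergodic

  open Words _*_
  open Translations _*_ up
  open Families _*_
  open Linking _*_ up F stable P per public

  opaque
    K : Fin n → Subset n
    K x = tabulate λ y → does (∼? x y)

    ∈K⁻ : ∀ {x y} → y ∈ K x → x ∼ y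
    ∈K⁻ {x} {y} y∈ = does≡true⁻ (∼? x y) (∈-tabulate⁻ y∈)

    ∈K⁺ : ∀ {x y} → x ∼ y → y ∈ K x
    ∈K⁺ {x} {y} x∼y = ∈-tabulate⁺ (does≡true⁺ (∼? x y) x∼y)

  𝒦 : Family _*_
  𝒦 C = ∃ λ x → C ≡ K x

  x∈K[x] : ∀ x → x ∈ K x
  x∈K[x] x = ∈K⁺ (∼-refl x)

  K-≡ : ∀ {x x′} → x ∼ x′ → K x ≡ K x′
  K-≡ x∼x′ = ⊆-antisym (λ y∈ → ∈K⁺ (∼-trans (∼-sym x∼x′) (∈K⁻ y∈))) (λ y∈ → ∈K⁺ (∼-trans x∼x′ (∈K⁻ y∈)))

  𝒦-partition : IsPartition _*_ 𝒦
  𝒦-partition = (λ { _ (x , refl) → x , x∈K[x] x })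
              , (λ x → K x , (x , refl) , x∈K[x] x)
              , (λ { _ _ (x , refl) (x′ , refl) (z , z∈) →
                     K-≡ (∼-trans (∈K⁻ (proj₁ (x∈p∩q⁻ (K x) (K x′) z∈))) (∼-sym (∈K⁻ (proj₂ (x∈p∩q⁻ (K x) (K x′) z∈))))) })

  -- conjugating by u and its inverse word keeps ∼-witnesses F-repeatable
  ∼-·ʳ : ∀ {x y} u → p ∣ length u → x ∼ y → x · u ∼ y · u
  ∼-·ʳ {x} {y} u p∣u (w , v , r , d , tw , xv≡y) =
    t ++ (w ++ u) , t ++ (v ++ u) ,
    Parallel-++ (Parallel-refl 0 t) (Parallel-period⁺ p∣t (Parallel-++ r (Parallel-refl _ u))) ,
    ∣length-++ {t} p∣t (∣length-++ {w} d p∣u) ,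
    (λ z → trans (·-++ z t (w ++ u)) (trans (·-++ (z · t) w u) (trans (cong (_· u) (tw (z · t))) (InverseWord.·-inverseˡ I z)))) ,
    trans (·-++ (x · u) t (v ++ u)) (trans (·-++ ((x · u) · t) v u) (cong (_· u) (trans (cong (_· v) (InverseWord.·-inverseʳ I x)) xv≡y)))
    where
      I = inverseWord P u
      t = InverseWord.inverse I
      p∣t : p ∣ length t
      p∣t = ∣m+n∣m⇒∣n (InverseWord.∣length I) p∣u

  K-·ˢ : ∀ x u → p ∣ length u → K x ·ˢ u ≡ K (x · u)
  K-·ˢ x u p∣u = ⊆-antisym ⊆K[xu] K[xu]⊆
    where
      I = inverseWord P u
      t = InverseWord.inverse I
      ⊆K[xu] : K x ·ˢ u ⊆ K (x · u)
      ⊆K[xu] z∈ with ∈·ˢ⁻ {K x} u z∈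
      ... | y , y∈ , refl = ∈K⁺ (∼-·ʳ u p∣u (∈K⁻ y∈))
      K[xu]⊆ : K (x · u) ⊆ K x ·ˢ u
      K[xu]⊆ {z} z∈ = subst (_∈ K x ·ˢ u) (InverseWord.·-inverseˡ I z) (∈·ˢ⁺ {K x} u (∈K⁺
        (subst (_∼ (z · t)) (InverseWord.·-inverseʳ I x) (∼-·ʳ t (∣m+n∣m⇒∣n (InverseWord.∣length I) p∣u) (∈K⁻ z∈)))))

  -- z · v lands in K x · w: it is reached from z ∈ K x along (w ++ w⁻¹, v ++ w⁻¹)
  K-·ˢ-Parallel : ∀ x {w v} → Parallel 0 w v → K x ·ˢ v ⊆ K x ·ˢ w
  K-·ˢ-Parallel x {w} {v} r z′∈ with ∈·ˢ⁻ {K x} v z′∈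
  ... | z , z∈ , refl = subst (_∈ K x ·ˢ w) (InverseWord.·-inverseˡ I (z · v)) (∈·ˢ⁺ {K x} w (∈K⁺ (∼-trans (∈K⁻ z∈) z∼)))
    where
      I = inverseWord P w
      t = InverseWord.inverse I
      z∼ : z ∼ (z · v) · t
      z∼ = w ++ t , v ++ t , Parallel-++ r (Parallel-refl _ t) , subst (p ∣_) (sym (length-++ w)) (InverseWord.∣length I) ,
           (λ a → trans (·-++ a w t) (InverseWord.·-inverseʳ I a)) , ·-++ z v t

  -- a word w with x · w = x and p ∣ |w| maps the block A ∋ x of F onto itself
  K⊆block : ∀ {x A} → F A → x ∈ A → K x ⊆ A
  K⊆block {x} {A} FA x∈ y∈ with ∈K⁻ y∈
  ... | w , v , r , divides c |w|≡ , tw , refl = subst (_ ∈_) Aw≡A (subst (_ ∈_) (sym (·ˢ-Parallel 0 FA r)) (∈·ˢ⁺ {A} v x∈))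
    where
      F[Aw] : F (A ·ˢ w)
      F[Aw] = proj₁ (pow-*-periodic F p F-periodic c _) (subst (λ k → pow _*_ F k (A ·ˢ w)) (trans (ℕP.+-identityʳ _) |w|≡) (pow-·ˢ 0 w FA))
      Aw≡A : A ·ˢ w ≡ A
      Aw≡A = pow-disjoint 0 F[Aw] FA (subst (_∈ A ·ˢ w) (tw x) (∈·ˢ⁺ {A} w x∈)) x∈

  K-·ˢ⊆pow : ∀ x u → ∃ λ B → pow _*_ F (length u) B × K x ·ˢ u ⊆ B
  K-·ˢ⊆pow x u with pow-covers 0 x
  ... | A , FA , x∈ = A ·ˢ u , subst (λ k → pow _*_ F k (A ·ˢ u)) (ℕP.+-identityʳ (length u)) (pow-·ˢ 0 u FA) ,
                      ⊛*-monoˡ (map ⁅_⁆ u) (K⊆block FA x∈)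

  ⊛-K-·ˢ : ∀ x u {C b} → (∃ λ B → pow _*_ F (length u) B × C ⊆ B) → b ∈ C → (K x ·ˢ u) ⊛′ C ≡ K x ·ˢ (u ∷ʳ b)
  ⊛-K-·ˢ x u {C} {b} (B , FB , C⊆B) b∈ = ⊆-antisym ⊆K·ub K·ub⊆
    where
      K·ub⊆ : K x ·ˢ (u ∷ʳ b) ⊆ (K x ·ˢ u) ⊛′ C
      K·ub⊆ z∈ with ∈·ˢ⁻ {K x} (u ∷ʳ b) z∈
      ... | y , y∈ , refl = subst (_∈ (K x ·ˢ u) ⊛′ C) (sym (·-++ y u (b ∷ []))) (∈⊛⁺ {K x ·ˢ u} {C} (∈·ˢ⁺ {K x} u y∈) b∈)
      ⊆K·ub : (K x ·ˢ u) ⊛′ C ⊆ K x ·ˢ (u ∷ʳ b)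
      ⊆K·ub z∈ with ∈⊛⁻ {K x ·ˢ u} {C} z∈
      ... | _ , c , yu∈ , c∈ , refl with ∈·ˢ⁻ {K x} u yu∈
      ...   | y , y∈ , refl = K-·ˢ-Parallel x ub∥uc (subst (_∈ K x ·ˢ (u ∷ʳ c)) (·-++ y u (c ∷ [])) (∈·ˢ⁺ {K x} (u ∷ʳ c) y∈))
        where
          ub∥uc : Parallel 0 (u ∷ʳ b) (u ∷ʳ c)
          ub∥uc = Parallel-++ (Parallel-refl 0 u) (subst (λ k → Parallel k (b ∷ []) (c ∷ [])) (sym (ℕP.+-identityʳ (length u)))
                                                           (sameBlock FB (C⊆B b∈) (C⊆B c∈) ∷ []))

  length-∷ʳ : ∀ u (b : Fin n) → length (u ∷ʳ b) ≡ suc (length u)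
  length-∷ʳ u b = trans (length-++ u) (ℕP.+-comm (length u) 1)

  pow-𝒦⁺ : ∀ k x u → length u ≡ k → pow _*_ 𝒦 k (K x ·ˢ u)
  pow-𝒦⁺ k x u |u|≡k with initLast u
  pow-𝒦⁺ zero    x _ refl | []       = x , refl
  pow-𝒦⁺ (suc k) x _ ()   | []
  pow-𝒦⁺ zero    x _ |u|≡ | u ∷ʳ′ b  = contradiction (trans (sym (length-∷ʳ u b)) |u|≡) λ ()
  pow-𝒦⁺ (suc k) x _ |u|≡ | u ∷ʳ′ b  =
    K x ·ˢ u , K z ·ˢ u , pow-𝒦⁺ k x u |u|≡k , pow-𝒦⁺ k z u |u|≡k , sym (⊛-K-·ˢ x u (K-·ˢ⊆pow z u) b∈)
    where
      |u|≡k : length u ≡ k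
      |u|≡k = ℕP.suc-injective (trans (sym (length-∷ʳ u b)) |u|≡)
      I = inverseWord P u
      z = b · InverseWord.inverse I
      b∈ : b ∈ K z ·ˢ u
      b∈ = subst (_∈ K z ·ˢ u) (InverseWord.·-inverseˡ I b) (∈·ˢ⁺ {K z} u (x∈K[x] z))

  pow-𝒦⁻ : ∀ k C → pow _*_ 𝒦 k C → ∃₂ λ x u → length u ≡ k × C ≡ K x ·ˢ u
  pow-𝒦⁻ zero    C (x , C≡) = x , [] , refl , C≡
  pow-𝒦⁻ (suc k) _ (C , C′ , 𝒦C , 𝒦C′ , refl) with pow-𝒦⁻ k C 𝒦C | pow-𝒦⁻ k C′ 𝒦C′
  ... | x , u , |u|≡k , refl | x′ , u′ , |u′|≡k , refl =
    x , u ∷ʳ (x′ · u′) , trans (length-∷ʳ u _) (cong suc |u|≡k) , ⊛-K-·ˢ x u block′ (∈·ˢ⁺ {K x′} u′ (x∈K[x] x′))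
    where
      block′ : ∃ λ B → pow _*_ F (length u) B × K x′ ·ˢ u′ ⊆ B
      block′ with K-·ˢ⊆pow x′ u′
      ... | B , FB , ⊆B = B , subst (λ j → pow _*_ F j B) (trans |u′|≡k (sym |u|≡k)) FB , ⊆B

  p∣length : ∀ (u : List (Fin n)) → length u ≡ p → p ∣ length u
  p∣length _ |u|≡p = ∣-reflexive (sym |u|≡p)

  𝒦-periodic : pow _*_ 𝒦 p ≐′ 𝒦
  𝒦-periodic C = to , from
    where
      to : pow _*_ 𝒦 p C → 𝒦 C
      to 𝒦C with pow-𝒦⁻ p C 𝒦C
      ... | x , u , |u|≡p , refl = x · u , K-·ˢ x u (p∣length u |u|≡p)
      from : 𝒦 C → pow _*_ 𝒦 p C
      from (x , refl) = subst (pow _*_ 𝒦 p) Kz·u≡Kx (pow-𝒦⁺ p z u |u|≡p)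
        where
          u = (x ∷ []) ^ʷ p
          |u|≡p : length u ≡ p
          |u|≡p = trans (length-^ʷ (x ∷ []) p) (ℕP.*-identityʳ p)
          I = inverseWord P u
          z = x · InverseWord.inverse I
          Kz·u≡Kx : K z ·ˢ u ≡ K x
          Kz·u≡Kx = trans (K-·ˢ z u (p∣length u |u|≡p)) (cong K (InverseWord.·-inverseˡ I x))

  Vec-foldl-· : ∀ {m} (xs : Vec.Vec (Fin n) m) a → Vec.foldl _ _*_ a xs ≡ a · Vec.toList xs
  Vec-foldl-· Vec.[]       a = refl
  Vec-foldl-· (x Vec.∷ xs) a = Vec-foldl-· xs (a * x)

  length-toList : ∀ {m} (xs : Vec.Vec (Fin n) m) → length (Vec.toList xs) ≡ m
  length-toList Vec.[]       = refl
  length-toList (x Vec.∷ xs) = cong suc (length-toList xs)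

  -- by ergodicity x · c = y and y · c′ = y with |c| = |c′| = l; then W = c c′ᴾ has length p·l
  𝒦-balanced : IsBalanced _*_ 𝒦
  𝒦-balanced _ _ (x , refl) (y , refl) = trans (sym (∣·ˢ∣ (K x) W)) (cong ∣_∣ (trans (K-·ˢ x W p∣W) (cong K xW≡y)))
    where
      l = proj₁ (proj₂ ergodic)
      connect = proj₂ (proj₂ (proj₂ ergodic))
      c  = Vec.toList (proj₁ (connect x y))
      c′ = Vec.toList (proj₁ (connect y y))
      W = c ++ c′ ^ʷ P
      xc≡y : x · c ≡ y
      xc≡y = trans (sym (Vec-foldl-· (proj₁ (connect x y)) x)) (proj₂ (connect x y))
      yc′≡y : y · c′ ≡ y
      yc′≡y = trans (sym (Vec-foldl-· (proj₁ (connect y y)) y)) (proj₂ (connect y y))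
      yc′ᵏ≡y : ∀ k → y · c′ ^ʷ k ≡ y
      yc′ᵏ≡y zero    = refl
      yc′ᵏ≡y (suc k) = trans (·-++ y c′ (c′ ^ʷ k)) (trans (cong (_· c′ ^ʷ k) yc′≡y) (yc′ᵏ≡y k))
      xW≡y : x · W ≡ y
      xW≡y = trans (·-++ x c (c′ ^ʷ P)) (trans (cong (_· c′ ^ʷ P) xc≡y) (yc′ᵏ≡y P))
      p∣W : p ∣ length W
      p∣W = divides l (trans (length-++ c) (trans (cong₂ _+_ (length-toList (proj₁ (connect x y)))
              (trans (length-^ʷ c′ P) (cong (P ℕ.*_) (length-toList (proj₁ (connect y y)))))) (ℕP.*-comm p l)))

  𝒦-stable : IsStable _*_ 𝒦
  𝒦-stable = 𝒦-partition , 𝒦-balanced , p , s≤s z≤n , 𝒦-periodic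

  𝒦⪯F : _⪯_ _*_ 𝒦 F
  𝒦⪯F _ (x , refl) with pow-covers 0 x
  ... | A , FA , x∈ = A , FA , K⊆block FA x∈

  some-word : ∀ {i 𝔛} → SequenceFrom F i 𝔛 → ∃ λ u → u ∈ʷ 𝔛
  some-word []              = [] , []
  some-word {i} (FX ∷ seq) with pow-nonempty i FX | some-word seq
  ... | y , y∈ | u , u∈ = y ∷ u , y∈ ∷ u∈

  𝒦-sequence : ∀ C → 𝒦 C → ∀ 𝔛 → IsSeq _*_ F 𝔛 → pow _*_ 𝒦 (length 𝔛) (C ⊛*′ 𝔛)
  𝒦-sequence _ (x , refl) 𝔛 seq with some-word (IsSeq⇒SequenceFrom 𝔛 seq)
  ... | u , u∈ = subst (pow _*_ 𝒦 (length 𝔛)) (sym K·𝔛≡K·u) (pow-𝒦⁺ (length 𝔛) x u (Pointwise-length u∈))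
    where
      K·𝔛≡K·u : K x ⊛*′ 𝔛 ≡ K x ·ˢ u
      K·𝔛≡K·u = ⊆-antisym
        (λ z∈ → let (y , u′ , y∈ , u′∈ , eq) = ∈⊛*⁻ 𝔛 z∈ in
                subst (_∈ K x ·ˢ u) eq (K-·ˢ-Parallel x (∈ʷ⇒Parallel (IsSeq⇒SequenceFrom 𝔛 seq) u∈ u′∈) (∈·ˢ⁺ {K x} u′ y∈)))
        (λ z∈ → let (y , y∈ , eq) = ∈·ˢ⁻ {K x} u z∈ in subst (_∈ K x ⊛*′ 𝔛) eq (∈⊛*⁺ {𝔛} {K x} y∈ u∈))

  period-unique : ∀ {p′} → IsPer _*_ F p′ → p′ ≡ p
  period-unique (p′>0 , per′ , minimal′) = ℕP.≤-antisym (minimal′ p (s≤s z≤n) F-periodic) (proj₂ (proj₂ per) _ p′>0 per′)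

  𝒦-absorbs : ∀ C → 𝒦 C → ∀ x → x ∈ C → ∀ 𝔛 → IsAugmenting _*_ F 𝔛 → ⁅ x ⁆ ⊛*′ 𝔛 ⊆ C
  𝒦-absorbs _ (x₀ , refl) x x∈ 𝔛 ((seq , p′ , per′ , p′∣𝔛) , augments) {z} z∈
    with ∈⊛*⁻ 𝔛 {⁅ x ⁆} z∈ | ∈⊛*⁻ 𝔛 {⁅ x ⁆} (augments ⁅ x ⁆ (x∈⁅x⁆ x))
  ... | _ , v , x′∈ , v∈ , xv≡z | _ , w , x″∈ , w∈ , xw≡x
    with refl ← x∈⁅y⁆⇒x≡y x x′∈ | refl ← x∈⁅y⁆⇒x≡y x x″∈ =
    subst (z ∈_) (sym (K-≡ (∈K⁻ x∈))) (∈K⁺ (∼ₓ⇒∼ (w , v , ∈ʷ⇒Parallel (IsSeq⇒SequenceFrom 𝔛 seq) w∈ v∈ , p∣w , xw≡x , xv≡z)))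
    where
      p∣w : p ∣ length w
      p∣w = subst (p ∣_) (sym (Pointwise-length w∈)) (subst (_∣ length 𝔛) (period-unique per′) p′∣𝔛)

  record Cover (x : Fin n) {k} (g : Fin k → Fin n) : Set where
    field
      𝔛          : List (Subset n)
      sequence   : SequenceFrom F 0 𝔛
      p∣𝔛        : p ∣ length 𝔛
      w₀         : List (Fin n)
      w₀∈𝔛       : w₀ ∈ʷ 𝔛
      w₀-trivial : Trivial w₀
      reaches    : ∀ i → x ∼ g i → ∃ λ u → u ∈ʷ 𝔛 × x · u ≡ g i

  -- concatenate the sequences spelled by the witnesses of x ∼ g i
  cover : ∀ x k (g : Fin k → Fin n) → Cover x g
  cover x zero    g = record { 𝔛 = [] ; sequence = [] ; p∣𝔛 = p ∣0 ; w₀ = [] ; w₀∈𝔛 = [] ; w₀-trivial = λ _ → refl ; reaches = λ () }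
  cover x (suc k) g with cover x k (g ∘ fsuc) | ∼? x (g fzero)
  ... | c | no x≁g₀ = record { Cover c ; reaches = λ { fzero x∼g₀ → contradiction x∼g₀ x≁g₀ ; (fsuc i) → Cover.reaches c i } }
  ... | c | yes (w , v , r , p∣w , tw , xv≡g₀) with Parallel⇒∈ʷ r
  ...   | 𝔜 , seq𝔜 , w∈ , v∈ = record
    { 𝔛          = 𝔜 ++ 𝔛
    ; sequence   = SequenceFrom-++ seq𝔜 (SequenceFrom-period⁺ p∣𝔜 sequence)
    ; p∣𝔛        = subst (p ∣_) (sym (length-++ 𝔜)) (∣m∣n⇒∣m+n p∣𝔜 p∣𝔛)
    ; w₀         = w ++ w₀
    ; w₀∈𝔛       = ∈ʷ-++ w∈ w₀∈𝔛
    ; w₀-trivial = Trivial-++ {w} {w₀} tw w₀-trivial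
    ; reaches    = λ { fzero _ → v ++ w₀ , ∈ʷ-++ v∈ w₀∈𝔛 , trans (·-++ x v w₀) (trans (w₀-trivial (x · v)) xv≡g₀)
                     ; (fsuc i) x∼gᵢ → let (u , u∈ , xu≡gᵢ) = reaches i x∼gᵢ in
                         w ++ u , ∈ʷ-++ w∈ u∈ , trans (·-++ x w u) (trans (cong (_· u) (tw x)) xu≡gᵢ) }
    }
    where
      open Cover c
      p∣𝔜 : p ∣ length 𝔜
      p∣𝔜 = subst (p ∣_) (Pointwise-length w∈) p∣w

  𝒦-augmenting : ∀ C → 𝒦 C → ∀ x → x ∈ C → ∃ λ 𝔛 → IsAugmenting _*_ F 𝔛 × ⁅ x ⁆ ⊛*′ 𝔛 ≡ C
  𝒦-augmenting _ (x₀ , refl) x x∈ = 𝔛 , augmenting , sym (trans (K-≡ (∈K⁻ x∈)) (⊆-antisym K[x]⊆ x𝔛⊆K[x]))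
    where
      open Cover (cover x n id)
      augmenting : IsAugmenting _*_ F 𝔛
      augmenting = (SequenceFrom⇒IsSeq 𝔛 sequence , p , per , p∣𝔛)
                 , λ A {a} a∈ → subst (_∈ A ⊛*′ 𝔛) (w₀-trivial a) (∈⊛*⁺ {𝔛} {A} a∈ w₀∈𝔛)
      x𝔛⊆K[x] : ⁅ x ⁆ ⊛*′ 𝔛 ⊆ K x
      x𝔛⊆K[x] = 𝒦-absorbs (K x) (x , refl) x (x∈K[x] x) 𝔛 augmenting
      K[x]⊆ : K x ⊆ ⁅ x ⁆ ⊛*′ 𝔛
      K[x]⊆ {y} y∈ = let (u , u∈ , xu≡y) = reaches y (∈K⁻ y∈) in subst (_∈ ⁅ x ⁆ ⊛*′ 𝔛) xu≡y (∈⊛*⁺ {𝔛} {⁅ x ⁆} (x∈⁅x⁆ x) u∈)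

  𝒦-isKH : IsKH _*_ F 𝒦
  𝒦-isKH = 𝒦-stable , 𝒦⪯F , 𝒦-sequence , 𝒦-augmenting , 𝒦-absorbs

module Uniqueness {n : ℕ} (_*_ : Op n) where
  open Families _*_

  -- the blocks of K and K′ through x are both of the form x ∗ 𝔛 with 𝔛 augmenting, by (ii), and so
  -- contain each other, by (iii)
  IsKH-unique : ∀ {H K K′} → IsKH _*_ H K → IsKH _*_ H K′ → K ≐′ K′
  IsKH-unique {H} KH K′H C = ⊆-block KH K′H , ⊆-block K′H KH
    where
      ⊆-block : ∀ {K K′} → IsKH _*_ H K → IsKH _*_ H K′ → K C → K′ C
      ⊆-block {K} {K′} (((nonempty , _) , _) , _ , _ , augmenting , absorbs) (((_ , covers , _) , _) , _ , _ , augmenting′ , absorbs′) KC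
        with nonempty C KC
      ... | x , x∈C with covers x
      ...   | C′ , K′C′ , x∈C′ with augmenting C KC x x∈C | augmenting′ C′ K′C′ x x∈C′
      ...     | 𝔛 , aug , x𝔛≡C | 𝔛′ , aug′ , x𝔛′≡C′ = subst K′ (sym C≡C′) K′C′
        where
          C≡C′ : C ≡ C′
          C≡C′ = ⊆-antisym (subst (_⊆ C′) x𝔛≡C (absorbs′ C′ K′C′ x x∈C′ 𝔛 aug))
                           (subst (_⊆ C) x𝔛′≡C′ (absorbs C KC x x∈C 𝔛′ aug′))

  IsKH-resp-≐ : ∀ {H K K′} → IsKH _*_ H K → K ≐′ K′ → IsKH _*_ H K′
  IsKH-resp-≐ {H} {K} {K′} (((nonempty , covers , disjoint) , balanced , m , m>0 , periodic) , ⪯H , (i) , (ii) , (iii)) K≐K′ =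
      ( ( (λ A → nonempty A ∘ from)
        , (λ x → let (C , KC , x∈) = covers x in C , to KC , x∈)
        , (λ A B KA KB → disjoint A B (from KA) (from KB)))
      , (λ A B KA KB → balanced A B (from KA) (from KB))
      , m , m>0 , ≐-trans (pow-cong (≐-sym K≐K′) m) (≐-trans periodic K≐K′))
    , (λ A → ⪯H A ∘ from)
    , (λ C KC 𝔛 seq → proj₁ (pow-cong K≐K′ (length 𝔛) _) ((i) C (from KC) 𝔛 seq))
    , (λ C → (ii) C ∘ from)
    , (λ C → (iii) C ∘ from)
    where
      to : ∀ {C} → K C → K′ C
      to {C} = proj₁ (K≐K′ C)
      from : ∀ {C} → K′ C → K C
      from {C} = proj₂ (K≐K′ C)

module PowerComparison {n : ℕ} (_*_ : Op n) (ergodic : Ergodic _*_) (H : Family _*_) (stable : IsStable _*_ H)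
                       (P : ℕ) (per : IsPer _*_ H (suc P)) (l : ℕ) where
  private
    up = proj₁ ergodic
  open Words _*_
  open Translations _*_ up
  open Families _*_

  module K₀ = KPartition _*_ ergodic H stable P per
  module Kₗ = KPartition _*_ ergodic (pow _*_ H l) (K₀.pow-stable l) P (K₀.IsPer-pow l (suc P) per)
  open K₀ using (p)

  Parallelˡ⇒ : ∀ {i w v} → Kₗ.Parallel i w v → K₀.Parallel (i + l) w v
  Parallelˡ⇒ Kₗ.[] = K₀.[]
  Parallelˡ⇒ {i} (Kₗ.sameBlock {C} HC y∈ y′∈ Kₗ.∷ r) = K₀.sameBlock (subst (λ G → G C) (pow-pow H l i) HC) y∈ y′∈ K₀.∷ Parallelˡ⇒ r

  Parallelˡ⇐ : ∀ {i w v} → K₀.Parallel (i + l) w v → Kₗ.Parallel i w v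
  Parallelˡ⇐ {w = []}    {[]}    K₀.[] = Kₗ.[]
  Parallelˡ⇐ {i} {_ ∷ _} {_ ∷ _} (K₀.sameBlock {C} HC y∈ y′∈ K₀.∷ r) =
    Kₗ.sameBlock (subst (λ G → G C) (sym (pow-pow H l i)) HC) y∈ y′∈ Kₗ.∷ Parallelˡ⇐ r

  ∣length-++-++ : ∀ (u w t : List (Fin n)) → p ∣ length u + length t → p ∣ length w → p ∣ length (u ++ (w ++ t))
  ∣length-++-++ u w t p∣ut p∣w = subst (p ∣_) (sym |uwt|≡) (∣m∣n⇒∣m+n p∣w p∣ut)
    where
      |uwt|≡ : length (u ++ (w ++ t)) ≡ length w + (length u + length t)
      |uwt|≡ = trans (length-++ u) (trans (cong (length u +_) (length-++ w)) (x∙yz≈y∙xz (length u) (length w) (length t)))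

  -- words parallel over H^{l∗} from index 0 are parallel over H from index l; conjugate the ∼-witnesses by u
  -- (|u| = l) and its inverse word
  Kₗ-· : ∀ x u → length u ≡ l → Kₗ.K (x · u) ≡ K₀.K x ·ˢ u
  Kₗ-· x u |u|≡l = ⊆-antisym Kₗ⊆ ⊆Kₗ
    where
      I = inverseWord P u
      t = InverseWord.inverse I
      Kₗ⊆ : Kₗ.K (x · u) ⊆ K₀.K x ·ˢ u
      Kₗ⊆ {z} z∈ with Kₗ.∈K⁻ z∈
      ... | w , v , r , p∣w , tw , xuv≡z =
        subst (_∈ K₀.K x ·ˢ u) (InverseWord.·-inverseˡ I z) (∈·ˢ⁺ {K₀.K x} u (K₀.∈K⁺
          ( u ++ (w ++ t) , u ++ (v ++ t)
          , K₀.Parallel-++ (K₀.Parallel-refl 0 u)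
              (subst (λ k → K₀.Parallel k (w ++ t) (v ++ t)) (sym (trans (ℕP.+-identityʳ (length u)) |u|≡l))
                     (K₀.Parallel-++ (Parallelˡ⇒ r) (K₀.Parallel-refl _ t)))
          , ∣length-++-++ u w t (InverseWord.∣length I) p∣w
          , (λ a → begin
              a · (u ++ (w ++ t))   ≡⟨ ·-++ a u (w ++ t) ⟩
              (a · u) · (w ++ t)    ≡⟨ ·-++ (a · u) w t ⟩
              ((a · u) · w) · t     ≡⟨ cong (_· t) (tw (a · u)) ⟩
              (a · u) · t           ≡⟨ InverseWord.·-inverseʳ I a ⟩
              a                     ∎)
          , (begin
              x · (u ++ (v ++ t))   ≡⟨ ·-++ x u (v ++ t) ⟩
              (x · u) · (v ++ t)    ≡⟨ ·-++ (x · u) v t ⟩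
              ((x · u) · v) · t     ≡⟨ cong (_· t) xuv≡z ⟩
              z · t                 ∎))))
        where open ≡-Reasoning
      ⊆Kₗ : K₀.K x ·ˢ u ⊆ Kₗ.K (x · u)
      ⊆Kₗ z∈ with ∈·ˢ⁻ {K₀.K x} u z∈
      ... | y , y∈ , refl with K₀.∈K⁻ y∈
      ... | w , v , r , p∣w , tw , xv≡y = Kₗ.∈K⁺
          ( t ++ (w ++ u) , t ++ (v ++ u)
          , Parallelˡ⇐ (K₀.Parallel-++ (K₀.Parallel-refl l t)
              (subst (λ k → K₀.Parallel k (w ++ u) (v ++ u)) (ℕP.+-identityʳ _)
                     (K₀.Parallel-period⁺ p∣t+l (K₀.Parallel-++ r (K₀.Parallel-refl _ u)))))
          , ∣length-++-++ t w u (subst (p ∣_) (ℕP.+-comm (length u) (length t)) (InverseWord.∣length I)) p∣w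
          , (λ a → begin
              a · (t ++ (w ++ u))   ≡⟨ ·-++ a t (w ++ u) ⟩
              (a · t) · (w ++ u)    ≡⟨ ·-++ (a · t) w u ⟩
              ((a · t) · w) · u     ≡⟨ cong (_· u) (tw (a · t)) ⟩
              (a · t) · u           ≡⟨ InverseWord.·-inverseˡ I a ⟩
              a                     ∎)
          , (begin
              (x · u) · (t ++ (v ++ u))   ≡⟨ ·-++ (x · u) t (v ++ u) ⟩
              ((x · u) · t) · (v ++ u)    ≡⟨ cong (_· (v ++ u)) (InverseWord.·-inverseʳ I x) ⟩
              x · (v ++ u)                ≡⟨ ·-++ x v u ⟩
              (x · v) · u                 ≡⟨ cong (_· u) xv≡y ⟩
              y · u                       ∎))
        where
          open ≡-Reasoning
          p∣t+l : p ∣ length t + l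
          p∣t+l = subst (p ∣_) (trans (ℕP.+-comm (length u) (length t)) (cong (length t +_) |u|≡l)) (InverseWord.∣length I)

  pow-𝒦≐𝒦-pow : pow _*_ K₀.𝒦 l ≐′ Kₗ.𝒦
  pow-𝒦≐𝒦-pow C = to , from
    where
      to : pow _*_ K₀.𝒦 l C → Kₗ.𝒦 C
      to 𝒦C with K₀.pow-𝒦⁻ l C 𝒦C
      ... | x , u , |u|≡l , refl = x · u , sym (Kₗ-· x u |u|≡l)
      from : Kₗ.𝒦 C → pow _*_ K₀.𝒦 l C
      from (z , refl) = subst (pow _*_ K₀.𝒦 l) K₀x·u≡Kₗz (K₀.pow-𝒦⁺ l x u |u|≡l)
        where
          u = (z ∷ []) ^ʷ l
          |u|≡l : length u ≡ l
          |u|≡l = trans (length-^ʷ (z ∷ []) l) (ℕP.*-identityʳ l)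
          I = inverseWord P u
          x = z · InverseWord.inverse I
          K₀x·u≡Kₗz : K₀.K x ·ˢ u ≡ Kₗ.K z
          K₀x·u≡Kₗz = trans (sym (Kₗ-· x u |u|≡l)) (cong Kₗ.K (InverseWord.·-inverseˡ I z))

mainTheorem1 : (n : ℕ) (_*_ : Op n) → Ergodic _*_ →
    (H : Family _*_) → IsStable _*_ H →
    ∃[ K ] ( IsKH _*_ H K
           × (∀ K′ → IsKH _*_ H K′ → _≐_ _*_ K′ K)
           × (∀ (l : ℕ) → IsKH _*_ (pow _*_ H l) (pow _*_ K l)
                        × (∀ K′ → IsKH _*_ (pow _*_ H l) K′ → _≐_ _*_ K′ (pow _*_ K l))))
mainTheorem1 n _*_ ergodic H stable with PowersOfStable.period _*_ (proj₁ ergodic) H stable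
... | suc P , per =
  K₀.𝒦 , K₀.𝒦-isKH , (λ K′ K′H → IsKH-unique K′H K₀.𝒦-isKH) ,
  λ l → let open PowerComparison _*_ ergodic H stable P per l in
        IsKH-resp-≐ Kₗ.𝒦-isKH (≐-sym pow-𝒦≐𝒦-pow) ,
        λ K′ K′Hˡ → ≐-trans (IsKH-unique K′Hˡ Kₗ.𝒦-isKH) (≐-sym pow-𝒦≐𝒦-pow)
  where
    open Families _*_
    open Uniqueness _*_
    module K₀ = KPartition _*_ ergodic H stable P per
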